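{- For every prime power $q$ and integers $n,j\ge1$, there is a function $b$ on $\mathcal{M}_n$ supported on squareful polynomials such that for all $f\in\mathcal{M}_n$, $$\Lambda_j(f)=\sum_{r=1}^n(-1)^{n-r}\big(r^j-(r-1)^j\big)X^{(r,1^{n-r})}(f)+b(f).$$
   Context: $\mathcal{M}_n$ is the set of monic polynomials of degree $n$ in $\mathbb{F}_q[T]$; squareful means having a repeated irreducible factor. $\Lambda_j(f)=\sum_{g\mid f,\ g\text{ monic}}\mu(g)\deg(f/g)^j$, where $\mu$ is the Möbius function ($\mu(g)=(-1)^\ell$ if $g$ is a product of $\ell$ distinct monic irreducibles, $0$ if $g$ has a repeated factor). $(r,1^{n-r})$ is the partition of $n$ with one part $r$ and $n-r$ ones. For $\lambda\vdash n$, $X^\lambda$ is the irreducible character of $\mathfrak{S}_n$ indexed by $\lambda$, and $X^\lambda(f)$ is its value on permutations of cycle type $(d_1,\dots,d_k)$ if $f\in\mathcal{M}_n$ is squarefree with irreducible factors of degrees $d_1\ge\cdots\ge d_k$, and $0$ otherwise. -}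

module Defs where

open import Level using (0ℓ)
open import Data.Nat as ℕ using (ℕ; zero; suc; _∸_; _^_; _≤_; _<ᵇ_; _≤ᵇ_; _≡ᵇ_)
open import Data.Nat.Primality using (Prime)
open import Data.Integer as ℤ using (ℤ; +_; 0ℤ; 1ℤ)
open import Data.Bool using (Bool; true; false; if_then_else_; _∧_; not)
open import Data.List as L using (List; []; _∷_; [_]; map; concatMap; length; upTo; foldr; replicate; _++_)
open import Data.Bool.ListAction using (any; all)
open import Data.List.Properties using (≡-dec)
open import Data.List.Membership.Propositional using (_∈_)
open import Data.List.Relation.Unary.Unique.Propositional using (Unique)
open import Data.Vec as V using (Vec; []; _∷_; toList)
open import Data.Product using (Σ; _×_; _,_)
open import Data.Sum using (_⊎_)
open import Relation.Nullary using (¬_; does)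
open import Relation.Binary.PropositionalEquality using (_≡_)
open import Relation.Binary.Definitions using (DecidableEquality)
open import Algebra.Structures using (IsCommutativeRing)

filterB : {A : Set} → (A → Bool) → List A → List A
filterB p [] = []
filterB p (x ∷ xs) = if p x then x ∷ filterB p xs else filterB p xs

IsPrimePower : ℕ → Set
IsPrimePower q = Σ ℕ λ p → Σ ℕ λ k → Prime p × 1 ≤ k × q ≡ p ^ k

record FiniteField : Set₁ where
  field
    Carrier  : Set
    _≟_      : DecidableEquality Carrier
    _+_ _*_  : Carrier → Carrier → Carrier
    -_       : Carrier → Carrier
    0# 1#    : Carrier
    isCommutativeRing : IsCommutativeRing _≡_ _+_ _*_ -_ 0# 1#
    0≢1      : ¬ (0# ≡ 1#)
    inverse  : ∀ x → ¬ (x ≡ 0#) → Σ Carrier λ y → x * y ≡ 1#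
    elements : List Carrier
    complete : ∀ x → x ∈ elements
    unique   : Unique elements

  size : ℕ
  size = length elements

module _ (F : FiniteField) where
  open FiniteField F

  -- polynomials as coefficient lists, constant term first
  Poly : Set
  Poly = List Carrier

  -- monic polynomial of degree n: coefficients c₀ … c_{n-1}, leading 1
  Monic : ℕ → Set
  Monic n = Vec Carrier n

  toPoly : ∀ {n} → Monic n → Poly
  toPoly m = toList m ++ [ 1# ]

  addP : Poly → Poly → Poly
  addP [] q = q
  addP (a ∷ p) [] = a ∷ p
  addP (a ∷ p) (b ∷ q) = (a + b) ∷ addP p q

  mulP : Poly → Poly → Poly
  mulP [] q = []
  mulP (a ∷ p) q = addP (map (a *_) q) (0# ∷ mulP p q)

  allMonic : (d : ℕ) → List (Monic d)
  allMonic zero = [ [] ]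
  allMonic (suc d) = concatMap (λ c → map (c ∷_) (allMonic d)) elements

  eqP : Poly → Poly → Bool
  eqP p q = does (≡-dec _≟_ p q)

  DividesP : Poly → Poly → Set
  DividesP g f = Σ ℕ λ k → Σ (Monic k) λ h → mulP g (toPoly h) ≡ f

  Irreducible : ∀ {e} → Monic e → Set
  Irreducible {e} p =
    1 ≤ e ×
    (∀ k l (a : Monic k) (b : Monic l) →
       mulP (toPoly a) (toPoly b) ≡ toPoly p → k ≡ 0 ⊎ l ≡ 0)

  Squareful : ∀ {n} → Monic n → Set
  Squareful f = Σ ℕ λ e → Σ (Monic e) λ p →
    Irreducible p × DividesP (mulP (toPoly p) (toPoly p)) (toPoly f)

  -- Computable versions (finite search) used to define μ, Λ_j, X^λ

  range1 : ℕ → List ℕ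
  range1 n = map suc (upTo n)

  range0 : ℕ → List ℕ
  range0 n = upTo (suc n)

  dividesB : Poly → ∀ {n} → Monic n → Bool
  dividesB g {n} f =
    any (λ k → any (λ h → eqP (mulP g (toPoly h)) (toPoly f)) (allMonic k)) (range0 n)

  irrB : ∀ {e} → Monic e → Bool
  irrB {e} p = (1 ≤ᵇ e) ∧ not
    (any (λ k → any (λ a → any (λ b → eqP (mulP (toPoly a) (toPoly b)) (toPoly p))
                               (allMonic (e ∸ k)))
                    (allMonic k))
         (range1 (e ∸ 1)))

  squarefreeB : ∀ {n} → Monic n → Bool
  squarefreeB {n} f = not (any (λ e → any (λ p → irrB p ∧ dividesB (mulP (toPoly p) (toPoly p)) f)
                                           (allMonic e))
                               (range1 n))

  -- degrees of the distinct monic irreducible divisors of f (with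
  -- multiplicity one per irreducible divisor)
  irrDivisorDegrees : ∀ {n} → Monic n → List ℕ
  irrDivisorDegrees {n} f =
    concatMap (λ e → map (λ _ → e) (filterB (λ p → irrB p ∧ dividesB (toPoly p) f)
                                            (allMonic e)))
              (range1 n)

  signℤ : ℕ → ℤ
  signℤ zero = 1ℤ
  signℤ (suc k) = ℤ.- signℤ k

  sumℤ : List ℤ → ℤ
  sumℤ = foldr ℤ._+_ 0ℤ

  μ : ∀ {d} → Monic d → ℤ
  μ g = if squarefreeB g then signℤ (length (irrDivisorDegrees g)) else 0ℤ

  -- Λ_j(f) = Σ_{g ∣ f monic} μ(g) deg(f/g)^j, written as a sum over
  -- factorisations f = g · h with g, h monic (h = f/g is unique).
  Λ : ℕ → ∀ {n} → Monic n → ℤ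
  Λ j {n} f = sumℤ (map (λ d → sumℤ (map (λ g → sumℤ (map (λ h →
        if eqP (mulP (toPoly g) (toPoly h)) (toPoly f)
        then μ g ℤ.* (+ ((n ∸ d) ^ j)) else 0ℤ)
      (allMonic (n ∸ d)))) (allMonic d))) (range0 n))

-- Irreducible characters of the symmetric group via the
-- Murnaghan–Nakayama rule, on beta-sets.

beta : List ℕ → List ℕ
beta [] = []
beta (x ∷ xs) = (x ℕ.+ length xs) ∷ beta xs

memB : ℕ → List ℕ → Bool
memB x = any (λ y → x ≡ᵇ y)

sgn : ℕ → ℤ
sgn zero = 1ℤ
sgn (suc k) = ℤ.- sgn k

sumZ : List ℤ → ℤ
sumZ = foldr ℤ._+_ 0ℤ

-- χ(β, μ): remove rim hooks of lengths μ₁, μ₂, … in turn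
chiβ : List ℕ → List ℕ → ℤ
chiβ β [] = if all (λ b → b <ᵇ length β) β then 1ℤ else 0ℤ
chiβ β (r ∷ μs) = sumZ (map term β)
  where
  term : ℕ → ℤ
  term b = if (r ≤ᵇ b) ∧ not (memB (b ∸ r) β)
           then sgn (length (filterB (λ c → ((b ∸ r) <ᵇ c) ∧ (c <ᵇ b)) β))
                ℤ.* chiβ (map (λ c → if c ≡ᵇ b then b ∸ r else c) β) μs
           else 0ℤ

-- X^λ evaluated on a permutation of cycle type μ
χ : List ℕ → List ℕ → ℤ
χ λs μs = chiβ (beta λs) μs

hook : ℕ → ℕ → List ℕ
hook n r = r ∷ replicate (n ∸ r) 1

Xpoly : (F : FiniteField) → List ℕ → ∀ {n} → Monic F n → ℤ
Xpoly F λs f = if squarefreeB F f then χ λs (irrDivisorDegrees F f) else 0ℤ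

hookSum : (F : FiniteField) → (n j : ℕ) → Monic F n → ℤ
hookSum F n j f = sumZ (map (λ r →
    sgn (n ∸ r) ℤ.* ((+ (r ^ j)) ℤ.- (+ ((r ∸ 1) ^ j))) ℤ.* Xpoly F (hook n r) f)
  (map suc (upTo n)))

-- Let f be squarefree with irreducible factors P₁, …, P_k of degrees D = (d₁, …, d_k). By unique
-- factorisation (Euclid's lemma for monic irreducibles, from division with remainder) the monic
-- divisors of f are the subproducts ∏_{i∈S} P_i, with μ = (-1)^|S|, so
--   Λ_j(f) = Σ_{S ⊆ D} (-1)^|S| φ(Σ S)   with φ(s) = (n - s)^j.
-- On the character side, the Murnaghan–Nakayama rule on β-sets says that removing a rim hook of
-- length d from a hook shortens either its arm or its leg by d. Summed against (-1)^t (φ(t) - φ(t+1)),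
-- the arm terms give the sum for D ∖ d and the leg terms, after shifting t by d, give minus the same
-- sum for φ(d + ·), so that for every φ
--   Σ_t (-1)^t (φ(t) - φ(t+1)) X^{(n-t,1^t)}(D) = Σ_{S ⊆ D} (-1)^|S| φ(Σ S).
-- For φ(s) = (n - s)^j and t = n - r the left side is the hook sum, so b = Λ_j - (hook sum)
-- vanishes off the squareful polynomials.

module Submission where

open import Defs

module Lists where

  open import Data.Bool using (Bool; true; false; T; if_then_else_; _∧_; not)
  open import Data.Bool.ListAction using (any; all)
  import Data.Bool.Properties as 𝔹
  open import Data.Integer as ℤ using (ℤ; 0ℤ)
  import Data.Integer.Properties as ℤP
  open import Data.List using (List; []; _∷_; _++_; map; length; concatMap; filterᵇ)
  open import Data.List.Membership.Propositional using (_∈_; find)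
  open import Data.List.Membership.Propositional.Properties using (∈-filter⁺; ∈-filter⁻; ∈-concatMap⁺; ∈-concatMap⁻; ∈-++⁻; ∈-map⁻)
  open import Data.List.Membership.Propositional.Properties.WithK using (unique∧set⇒bag)
  open import Data.List.Properties using (map-++)
  open import Data.List.Relation.Binary.BagAndSetEquality using (∼bag⇒↭)
  open import Data.List.Relation.Binary.Permutation.Propositional using (_↭_; ↭⇒↭ₛ)
  open import Data.List.Relation.Binary.Permutation.Propositional.Properties using (map⁺; filter-↭; ↭-length)
  open import Data.List.Relation.Binary.Permutation.Setoid.Properties using (foldr-commMonoid)
  open import Data.List.Relation.Unary.All as All using (All)
  open import Data.List.Relation.Unary.Any as Any using (here; there)
  open import Data.List.Relation.Unary.Any.Properties using (any⁺; any⁻)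
  open import Data.List.Relation.Unary.AllPairs using ([]; _∷_)
  open import Data.List.Relation.Unary.Unique.Propositional using (Unique)
  import Data.List.Relation.Unary.Unique.Propositional.Properties as Unique
  open import Data.Product using (Σ; _×_; _,_)
  open import Data.Sum using (inj₁; inj₂)
  open import Algebra.Bundles using (CommutativeMonoid)
  open import Data.Empty using (⊥-elim)
  open import Function using (_∘_; mk⇔; Equivalence)
  open import Relation.Binary.PropositionalEquality
  open import Relation.Nullary using (¬_)
  open import Relation.Nullary.Decidable using (T?)

  private
    variable
      A B : Set

  false≢true : false ≢ true
  false≢true ()

  T⇒≡true : ∀ {b} → T b → b ≡ true
  T⇒≡true {true} _ = refl

  ¬T⇒≡false : ∀ {b} → ¬ T b → b ≡ false
  ¬T⇒≡false {true} ¬t = ⊥-elim (¬t _)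
  ¬T⇒≡false {false} _ = refl

  ∧-true⁻ : ∀ {a b} → (a ∧ b) ≡ true → a ≡ true × b ≡ true
  ∧-true⁻ {true} {true} _ = refl , refl

  not-true⁻ : ∀ {b} → not b ≡ true → b ≡ false
  not-true⁻ {false} _ = refl

  not-false⁻ : ∀ {b} → not b ≡ false → b ≡ true
  not-false⁻ {true} _ = refl

  filterB≗filterᵇ : (p : A → Bool) (xs : List A) → filterB p xs ≡ filterᵇ p xs
  filterB≗filterᵇ p [] = refl
  filterB≗filterᵇ p (x ∷ xs) with p x
  ... | true  = cong (x ∷_) (filterB≗filterᵇ p xs)
  ... | false = filterB≗filterᵇ p xs

  ∈-filterB⁺ : (p : A → Bool) {xs : List A} {x : A} → x ∈ xs → p x ≡ true → x ∈ filterB p xs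
  ∈-filterB⁺ p {xs} x∈xs px rewrite filterB≗filterᵇ p xs =
    ∈-filter⁺ (T? ∘ p) x∈xs (Equivalence.from 𝔹.T-≡ px)

  ∈-filterB⁻ : (p : A → Bool) {xs : List A} {x : A} → x ∈ filterB p xs → x ∈ xs × p x ≡ true
  ∈-filterB⁻ p {xs} x∈ rewrite filterB≗filterᵇ p xs with ∈-filter⁻ (T? ∘ p) x∈
  ... | x∈xs , px = x∈xs , Equivalence.to 𝔹.T-≡ px

  filterB⁺ : (p : A → Bool) {xs : List A} → Unique xs → Unique (filterB p xs)
  filterB⁺ p {xs} u rewrite filterB≗filterᵇ p xs = Unique.filter⁺ (T? ∘ p) u

  length-filterB-↭ : (p : A → Bool) {xs ys : List A} → xs ↭ ys → length (filterB p xs) ≡ length (filterB p ys)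
  length-filterB-↭ p {xs} {ys} xs↭ys rewrite filterB≗filterᵇ p xs | filterB≗filterᵇ p ys =
    ↭-length (filter-↭ (T? ∘ p) xs↭ys)

  any-true⁺ : (p : A → Bool) {xs : List A} {x : A} → x ∈ xs → p x ≡ true → any p xs ≡ true
  any-true⁺ p {x = x} x∈xs px =
    Equivalence.to 𝔹.T-≡ (any⁺ p (Any.map (λ { refl → Equivalence.from 𝔹.T-≡ px }) x∈xs))

  any-true⁻ : (p : A → Bool) (xs : List A) → any p xs ≡ true → Σ A λ x → x ∈ xs × p x ≡ true
  any-true⁻ p xs e with find (any⁻ p xs (Equivalence.from 𝔹.T-≡ e))
  ... | x , x∈xs , px = x , x∈xs , Equivalence.to 𝔹.T-≡ px

  any-↭ : (p : A → Bool) {xs ys : List A} → xs ↭ ys → any p xs ≡ any p ys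
  any-↭ p xs↭ys = foldr-commMonoid M.setoid M.isCommutativeMonoid (↭⇒↭ₛ (map⁺ p xs↭ys))
    where module M = CommutativeMonoid 𝔹.∨-commutativeMonoid

  all-↭ : (p : A → Bool) {xs ys : List A} → xs ↭ ys → all p xs ≡ all p ys
  all-↭ p xs↭ys = foldr-commMonoid M.setoid M.isCommutativeMonoid (↭⇒↭ₛ (map⁺ p xs↭ys))
    where module M = CommutativeMonoid 𝔹.∧-commutativeMonoid

  sumZ-↭ : {xs ys : List ℤ} → xs ↭ ys → sumZ xs ≡ sumZ ys
  sumZ-↭ xs↭ys = foldr-commMonoid M.setoid M.isCommutativeMonoid (↭⇒↭ₛ xs↭ys)
    where module M = CommutativeMonoid ℤP.+-0-commutativeMonoid

  Unique⇒↭ : {xs ys : List A} → Unique xs → Unique ys →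
    (∀ {x} → x ∈ xs → x ∈ ys) → (∀ {x} → x ∈ ys → x ∈ xs) → xs ↭ ys
  Unique⇒↭ u v to from = ∼bag⇒↭ (unique∧set⇒bag u v (mk⇔ to from))

  ∈-concatMap⁺′ : (f : A → List B) {xs : List A} {a : A} {b : B} → a ∈ xs → b ∈ f a → b ∈ concatMap f xs
  ∈-concatMap⁺′ f a∈xs b∈fa = ∈-concatMap⁺ f (Any.map (λ { refl → b∈fa }) a∈xs)

  ∈-concatMap⁻′ : (f : A → List B) (xs : List A) {b : B} → b ∈ concatMap f xs → Σ A λ a → a ∈ xs × b ∈ f a
  ∈-concatMap⁻′ f xs b∈ = find (∈-concatMap⁻ f b∈)

  Unique-concatMap⁺ : (f : A → List B) (key : B → A) {xs : List A} → Unique xs →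
    (∀ a → Unique (f a)) → (∀ a {b} → b ∈ f a → key b ≡ a) → Unique (concatMap f xs)
  Unique-concatMap⁺ f key {[]} _ _ _ = []
  Unique-concatMap⁺ f key {a ∷ xs} (a∉xs ∷ u) uf key-f =
    Unique.++⁺ (uf a) (Unique-concatMap⁺ f key u uf key-f) disjoint
    where
    disjoint : ∀ {b} → ¬ (b ∈ f a × b ∈ concatMap f xs)
    disjoint (b∈fa , b∈rest) with ∈-concatMap⁻′ f xs b∈rest
    ... | a′ , a′∈xs , b∈fa′ = All.lookup a∉xs a′∈xs (trans (sym (key-f a b∈fa)) (key-f a′ b∈fa′))

  sumZ-++ : ∀ xs ys → sumZ (xs ++ ys) ≡ sumZ xs ℤ.+ sumZ ys
  sumZ-++ [] ys = sym (ℤP.+-identityˡ _)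
  sumZ-++ (x ∷ xs) ys = trans (cong (λ z → x ℤ.+ z) (sumZ-++ xs ys)) (sym (ℤP.+-assoc x _ _))

  sumZ-map-cong : (f g : A → ℤ) (xs : List A) → (∀ {x} → x ∈ xs → f x ≡ g x) → sumZ (map f xs) ≡ sumZ (map g xs)
  sumZ-map-cong f g [] _ = refl
  sumZ-map-cong f g (x ∷ xs) f≡g = cong₂ ℤ._+_ (f≡g (here refl)) (sumZ-map-cong f g xs (f≡g ∘ there))

  sumZ-map-zero : (f : A → ℤ) (xs : List A) → (∀ {x} → x ∈ xs → f x ≡ 0ℤ) → sumZ (map f xs) ≡ 0ℤ
  sumZ-map-zero f xs f≡0 = trans (sumZ-map-cong f (λ _ → 0ℤ) xs f≡0) (sumZ-zeros xs)
    where
    sumZ-zeros : (xs : List A) → sumZ (map (λ _ → 0ℤ) xs) ≡ 0ℤ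
    sumZ-zeros [] = refl
    sumZ-zeros (_ ∷ xs) = trans (ℤP.+-identityˡ _) (sumZ-zeros xs)

  sumZ-map-neg : (f : A → ℤ) (xs : List A) → sumZ (map (ℤ.-_ ∘ f) xs) ≡ ℤ.- sumZ (map f xs)
  sumZ-map-neg f [] = refl
  sumZ-map-neg f (x ∷ xs) = trans (cong (λ z → ℤ.- f x ℤ.+ z) (sumZ-map-neg f xs)) (sym (ℤP.neg-distrib-+ (f x) _))

  sumZ-concatMap : (g : B → ℤ) (f : A → List B) (xs : List A) →
    sumZ (map (sumZ ∘ map g ∘ f) xs) ≡ sumZ (map g (concatMap f xs))
  sumZ-concatMap g f [] = refl
  sumZ-concatMap g f (x ∷ xs) = begin
    sumZ (map g (f x)) ℤ.+ sumZ (map (sumZ ∘ map g ∘ f) xs) ≡⟨ cong (λ z → sumZ (map g (f x)) ℤ.+ z) (sumZ-concatMap g f xs) ⟩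
    sumZ (map g (f x)) ℤ.+ sumZ (map g (concatMap f xs))   ≡⟨ sumZ-++ (map g (f x)) _ ⟨
    sumZ (map g (f x) ++ map g (concatMap f xs))           ≡⟨ cong sumZ (map-++ g (f x) (concatMap f xs)) ⟨
    sumZ (map g (f x ++ concatMap f xs))                   ∎
    where open ≡-Reasoning

  sumZ-map-if : (p : A → Bool) (w : A → ℤ) (xs : List A) →
    sumZ (map (λ x → if p x then w x else 0ℤ) xs) ≡ sumZ (map w (filterB p xs))
  sumZ-map-if p w [] = refl
  sumZ-map-if p w (x ∷ xs) with p x
  ... | true  = cong (λ z → w x ℤ.+ z) (sumZ-map-if p w xs)
  ... | false = trans (ℤP.+-identityˡ _) (sumZ-map-if p w xs)

  sumZ-map-if-unique : (p : A → Bool) (c : ℤ) {xs : List A} {x₀ : A} → Unique xs → x₀ ∈ xs → p x₀ ≡ true →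
    (∀ {y} → y ∈ xs → p y ≡ true → y ≡ x₀) → sumZ (map (λ y → if p y then c else 0ℤ) xs) ≡ c
  sumZ-map-if-unique p c {xs} {x₀} u x₀∈xs px₀ only-x₀ = begin
    sumZ (map (λ y → if p y then c else 0ℤ) xs) ≡⟨ sumZ-map-if p (λ _ → c) xs ⟩
    sumZ (map (λ _ → c) (filterB p xs))         ≡⟨ sumZ-↭ (map⁺ (λ _ → c) filtered↭[x₀]) ⟩
    c ℤ.+ 0ℤ                                     ≡⟨ ℤP.+-identityʳ c ⟩
    c                                            ∎
    where
    open ≡-Reasoning
    filtered↭[x₀] : filterB p xs ↭ x₀ ∷ []
    filtered↭[x₀] = Unique⇒↭ (filterB⁺ p u) (All.[] ∷ [])
      (λ y∈ → let y∈xs , py = ∈-filterB⁻ p y∈ in here (only-x₀ y∈xs py))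
      (λ { (here refl) → ∈-filterB⁺ p x₀∈xs px₀ })

  sublists : List A → List (List A)
  sublists [] = [] ∷ []
  sublists (x ∷ xs) = sublists xs ++ map (x ∷_) (sublists xs)

  sublists-⊆ : (xs : List A) {S : List A} → S ∈ sublists xs → ∀ {q} → q ∈ S → q ∈ xs
  sublists-⊆ [] (here refl) ()
  sublists-⊆ (x ∷ xs) S∈ q∈S with ∈-++⁻ (sublists xs) S∈
  ... | inj₁ S∈rest = there (sublists-⊆ xs S∈rest q∈S)
  ... | inj₂ S∈x∷rest with ∈-map⁻ (x ∷_) S∈x∷rest
  ...   | S′ , S′∈ , refl with q∈S
  ...     | here q≡x = here q≡x
  ...     | there q∈S′ = there (sublists-⊆ xs S′∈ q∈S′)

  sublists-unique : (xs : List A) → Unique xs → ∀ {S} → S ∈ sublists xs → Unique S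
  sublists-unique [] _ (here refl) = []
  sublists-unique (x ∷ xs) (x∉xs ∷ u) S∈ with ∈-++⁻ (sublists xs) S∈
  ... | inj₁ S∈rest = sublists-unique xs u S∈rest
  ... | inj₂ S∈x∷rest with ∈-map⁻ (x ∷_) S∈x∷rest
  ...   | S′ , S′∈ , refl = All.tabulate (λ q∈S′ → All.lookup x∉xs (sublists-⊆ xs S′∈ q∈S′)) ∷ sublists-unique xs u S′∈

module HookCharacters where

  open import Data.Bool using (Bool; true; false; if_then_else_; _∧_; not)
  open import Data.Bool.Properties using (∧-zeroʳ)
  open import Data.Empty using (⊥-elim)
  open import Data.Integer as ℤ using (ℤ; 0ℤ; 1ℤ)
  import Data.Integer.Properties as ℤP
  open import Data.List using (List; []; _∷_; _++_; map; length; replicate; upTo; applyUpTo)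
  open import Data.List.Membership.Propositional using (_∈_)
  open import Data.List.Membership.Propositional.Properties using (∈-++⁺ˡ; ∈-++⁺ʳ; ∈-++⁻)
  open import Data.List.Properties using (map-∘; map-++; length-++; ++-assoc; ++-identityʳ; map-id-local; length-replicate)
  open import Data.List.Relation.Binary.Permutation.Propositional using (_↭_; prep; swap; ↭-sym) renaming (refl to ↭-refl; trans to ↭-trans)
  open import Data.List.Relation.Binary.Permutation.Propositional.Properties using (map⁺; ↭-length; shift; ++⁺ˡ)
  open import Data.List.Relation.Unary.All as All using (All; _∷_)
  open import Data.List.Relation.Unary.All.Properties using (all⁻)
  open import Data.List.Relation.Unary.Any using (here; there)
  open import Data.Nat as ℕ using (ℕ; zero; suc; _+_; _∸_; _≤_; _<_; _<ᵇ_; _≤ᵇ_; _≡ᵇ_; z≤n; s≤s; z<s)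
  open import Data.Nat.Properties
  open import Data.Nat.ListAction using (sum)
  open import Data.Product using (_×_; _,_; proj₁; proj₂)
  open import Data.Sum using (_⊎_; inj₁; inj₂)
  open import Function using (_∘_)
  open import Relation.Binary.Definitions using (tri<; tri≈; tri>)
  open import Relation.Binary.PropositionalEquality
  open import Relation.Nullary using (yes; no)
  open Lists

  ≤ᵇ-true : ∀ {m n} → m ≤ n → (m ≤ᵇ n) ≡ true
  ≤ᵇ-true m≤n = T⇒≡true (≤⇒≤ᵇ m≤n)

  ≤ᵇ-false : ∀ {m n} → n < m → (m ≤ᵇ n) ≡ false
  ≤ᵇ-false {m} {n} n<m = ¬T⇒≡false (<⇒≱ n<m ∘ ≤ᵇ⇒≤ m n)

  <ᵇ-true : ∀ {m n} → m < n → (m <ᵇ n) ≡ true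
  <ᵇ-true m<n = T⇒≡true (<⇒<ᵇ m<n)

  <ᵇ-false : ∀ {m n} → n ≤ m → (m <ᵇ n) ≡ false
  <ᵇ-false {m} {n} n≤m = ¬T⇒≡false (≤⇒≯ n≤m ∘ <ᵇ⇒< m n)

  ≡ᵇ-true : ∀ {m n} → m ≡ n → (m ≡ᵇ n) ≡ true
  ≡ᵇ-true {m} {n} m≡n = T⇒≡true (≡⇒≡ᵇ m n m≡n)

  ≡ᵇ-false : ∀ {m n} → m ≢ n → (m ≡ᵇ n) ≡ false
  ≡ᵇ-false {m} {n} m≢n = ¬T⇒≡false (m≢n ∘ ≡ᵇ⇒≡ m n)

  memB-true : ∀ {y xs} → y ∈ xs → memB y xs ≡ true
  memB-true {y} y∈xs = any-true⁺ (y ≡ᵇ_) y∈xs (≡ᵇ-true {y} refl)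

  memB-false : ∀ {y xs} → (∀ {c} → c ∈ xs → c ≢ y) → memB y xs ≡ false
  memB-false {y} {[]} _ = refl
  memB-false {y} {x ∷ xs} ∉xs rewrite ≡ᵇ-false {y} {x} (∉xs (here refl) ∘ sym) = memB-false (∉xs ∘ there)

  length-filterB-none : (p : ℕ → Bool) (xs : List ℕ) → (∀ {c} → c ∈ xs → p c ≡ false) → length (filterB p xs) ≡ 0
  length-filterB-none p [] _ = refl
  length-filterB-none p (x ∷ xs) none rewrite none (here refl) = length-filterB-none p xs (none ∘ there)

  filterB-++ : (p : ℕ → Bool) (xs ys : List ℕ) → filterB p (xs ++ ys) ≡ filterB p xs ++ filterB p ys
  filterB-++ p [] ys = refl
  filterB-++ p (x ∷ xs) ys with p x
  ... | true = cong (x ∷_) (filterB-++ p xs ys)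
  ... | false = filterB-++ p xs ys

  replace : ℕ → ℕ → ℕ → ℕ
  replace x y c = if c ≡ᵇ x then y else c

  between : ℕ → ℕ → ℕ → Bool
  between lo hi c = (lo <ᵇ c) ∧ (c <ᵇ hi)

  -- The summand of chiβ β (r ∷ μs) for bead b (Murnaghan–Nakayama on β-sets), so that
  -- chiβ β (r ∷ μs) reduces to sumZ (map (rimHookTerm r μs β) β).
  rimHookTerm : ℕ → List ℕ → List ℕ → ℕ → ℤ
  rimHookTerm r μs β b =
    if (r ≤ᵇ b) ∧ not (memB (b ∸ r) β)
    then sgn (length (filterB (between (b ∸ r) b) β))
         ℤ.* chiβ (map (replace b (b ∸ r)) β) μs
    else 0ℤ

  chiβ-↭ : ∀ μs {β β′} → β ↭ β′ → chiβ β μs ≡ chiβ β′ μs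
  chiβ-↭ [] {β} {β′} β↭β′ rewrite ↭-length β↭β′ =
    cong (λ z → if z then 1ℤ else 0ℤ) (all-↭ (_<ᵇ length β′) β↭β′)
  chiβ-↭ (r ∷ μs) {β} {β′} β↭β′ =
    trans (sumZ-map-cong (rimHookTerm r μs β) (rimHookTerm r μs β′) β (λ {b} _ → same-term b))
          (sumZ-↭ (map⁺ (rimHookTerm r μs β′) β↭β′))
    where
    same-term : ∀ b → rimHookTerm r μs β b ≡ rimHookTerm r μs β′ b
    same-term b rewrite any-↭ ((b ∸ r) ≡ᵇ_) β↭β′
                      | length-filterB-↭ (between (b ∸ r) b) β↭β′
                      | chiβ-↭ μs (map⁺ (replace b (b ∸ r)) β↭β′) = refl

  rimHookTerm-short : ∀ r μs β x → x < r → rimHookTerm r μs β x ≡ 0ℤ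
  rimHookTerm-short r μs β x x<r rewrite ≤ᵇ-false {r} {x} x<r = refl

  rimHookTerm-blocked : ∀ r μs β x → memB (x ∸ r) β ≡ true → rimHookTerm r μs β x ≡ 0ℤ
  rimHookTerm-blocked r μs β x occupied rewrite occupied with r ≤ᵇ x
  ... | true = refl
  ... | false = refl

  rimHookTerm-free : ∀ r μs β x → r ≤ x → memB (x ∸ r) β ≡ false →
    rimHookTerm r μs β x ≡ sgn (length (filterB (between (x ∸ r) x) β))
                           ℤ.* chiβ (map (replace x (x ∸ r)) β) μs
  rimHookTerm-free r μs β x r≤x free rewrite ≤ᵇ-true r≤x | free = refl

  interval : ℕ → ℕ → List ℕ
  interval lo zero = []
  interval lo (suc k) = (lo + k) ∷ interval lo k

  ∈-interval⁺ : ∀ {lo y} k → lo ≤ y → y < lo + k → y ∈ interval lo k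
  ∈-interval⁺ {lo} {y} zero lo≤y y<lo+0 = ⊥-elim (<⇒≱ y<lo+0 (subst (_≤ y) (sym (+-identityʳ lo)) lo≤y))
  ∈-interval⁺ {lo} {y} (suc k) lo≤y y<lo+1+k with y ≟ lo + k
  ... | yes y≡ = here y≡
  ... | no y≢ = there (∈-interval⁺ k lo≤y (≤∧≢⇒< (≤-pred (subst (suc y ≤_) (+-suc lo k) y<lo+1+k)) y≢))

  ∈-interval⁻ : ∀ {lo y} k → y ∈ interval lo k → lo ≤ y × y < lo + k
  ∈-interval⁻ {lo} (suc k) (here refl) = m≤m+n lo k , subst (lo + k <_) (sym (+-suc lo k)) ≤-refl
  ∈-interval⁻ {lo} (suc k) (there y∈) with ∈-interval⁻ k y∈
  ... | lo≤y , y<lo+k = lo≤y , <-trans y<lo+k (+-monoʳ-< lo ≤-refl)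

  length-interval : ∀ lo k → length (interval lo k) ≡ k
  length-interval lo zero = refl
  length-interval lo (suc k) = cong suc (length-interval lo k)

  interval-+ : ∀ lo k m → interval lo (m + k) ≡ interval (lo + k) m ++ interval lo k
  interval-+ lo k zero = refl
  interval-+ lo k (suc m) =
    cong₂ _∷_ (trans (cong (lo +_) (+-comm m k)) (sym (+-assoc lo k m))) (interval-+ lo k m)

  -- The β-set {a} ∪ [b+1, b+t] ∪ [0, b) of the hook (a ∸ (b + t), 1^t) padded with b zero parts.
  hookβ : ℕ → ℕ → ℕ → List ℕ
  hookβ a b t = a ∷ (interval (suc b) t ++ interval 0 b)

  ∈-hookβ⁻ : ∀ {a b t y} → y ∈ hookβ a b t → y ≡ a ⊎ (b < y × y ≤ b + t) ⊎ y < b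
  ∈-hookβ⁻ (here y≡a) = inj₁ y≡a
  ∈-hookβ⁻ {a} {b} {t} (there y∈) with ∈-++⁻ (interval (suc b) t) y∈
  ... | inj₁ y∈leg = let b<y , y<1+b+t = ∈-interval⁻ t y∈leg in inj₂ (inj₁ (b<y , ≤-pred y<1+b+t))
  ... | inj₂ y∈pad = inj₂ (inj₂ (proj₂ (∈-interval⁻ b y∈pad)))

  memB-hookβ-leg : ∀ {a b t y} → b < y → y ≤ b + t → memB y (hookβ a b t) ≡ true
  memB-hookβ-leg {t = t} b<y y≤b+t = memB-true (there (∈-++⁺ˡ (∈-interval⁺ t b<y (s≤s y≤b+t))))

  memB-hookβ-pad : ∀ {a b t y} → y < b → memB y (hookβ a b t) ≡ true
  memB-hookβ-pad {b = b} {t} y<b = memB-true (there (∈-++⁺ʳ (interval (suc b) t) (∈-interval⁺ b z≤n y<b)))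

  memB-hookβ-gap : ∀ {a b t y} → y ≢ a → (y ≡ b ⊎ b + t < y) → memB y (hookβ a b t) ≡ false
  memB-hookβ-gap {a} {b} {t} {y} y≢a gap = memB-false (λ c∈ → apart (∈-hookβ⁻ c∈) gap)
    where
    apart : ∀ {c} → (c ≡ a ⊎ (b < c × c ≤ b + t) ⊎ c < b) → (y ≡ b ⊎ b + t < y) → c ≢ y
    apart (inj₁ c≡a) _ c≡y = y≢a (trans (sym c≡y) c≡a)
    apart (inj₂ (inj₁ (b<c , _))) (inj₁ y≡b) c≡y = <-irrefl (sym (trans c≡y y≡b)) b<c
    apart (inj₂ (inj₁ (_ , c≤b+t))) (inj₂ b+t<y) c≡y = <⇒≱ b+t<y (subst (_≤ b + t) c≡y c≤b+t)
    apart (inj₂ (inj₂ c<b)) (inj₁ y≡b) c≡y = <-irrefl (trans c≡y y≡b) c<b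
    apart (inj₂ (inj₂ c<b)) (inj₂ b+t<y) c≡y = <-asym c<b (subst (b <_) (sym c≡y) (≤-<-trans (m≤m+n b t) b+t<y))

  +-<ᵇ-cancelˡ : ∀ n j i → ((n + j) <ᵇ (n + i)) ≡ (j <ᵇ i)
  +-<ᵇ-cancelˡ zero j i = refl
  +-<ᵇ-cancelˡ (suc n) j i = +-<ᵇ-cancelˡ n j i

  length-filterB-interval : (p : ℕ → Bool) (lo k m : ℕ) → (∀ j → j < k → p (lo + j) ≡ (j <ᵇ m)) →
    length (filterB p (interval lo k)) ≡ k ℕ.⊓ m
  length-filterB-interval p lo zero m _ = refl
  length-filterB-interval p lo (suc k) m p≡ with k <? m
  ... | yes k<m rewrite p≡ k ≤-refl | <ᵇ-true k<m =
    trans (cong suc (length-filterB-interval p lo k m (λ j j<k → p≡ j (m<n⇒m<1+n j<k))))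
          (trans (cong suc (m≤n⇒m⊓n≡m (<⇒≤ k<m))) (sym (m≤n⇒m⊓n≡m k<m)))
  ... | no k≮m rewrite p≡ k ≤-refl | <ᵇ-false {k} {m} (≮⇒≥ k≮m) =
    trans (length-filterB-interval p lo k m (λ j j<k → p≡ j (m<n⇒m<1+n j<k)))
          (trans (m≥n⇒m⊓n≡n (≮⇒≥ k≮m)) (sym (m≥n⇒m⊓n≡n (m≤n⇒m≤1+n (≮⇒≥ k≮m)))))

  replace-hit : ∀ x y → replace x y x ≡ y
  replace-hit x y rewrite ≡ᵇ-true {x} refl = refl

  replace-miss : ∀ {x y c} → c ≢ x → replace x y c ≡ c
  replace-miss {x} {c = c} c≢x rewrite ≡ᵇ-false {c} {x} c≢x = refl

  count-hookβ-between : ∀ a b t x m → x ≤ a → (∀ j → j < t → (suc b + j <ᵇ x) ≡ (j <ᵇ m)) →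
    length (filterB (between b x) (hookβ a b t)) ≡ t ℕ.⊓ m
  count-hookβ-between a b t x m x≤a legs
    rewrite <ᵇ-false {a} {x} x≤a | ∧-zeroʳ (b <ᵇ a)
          | filterB-++ (between b x) (interval (suc b) t) (interval 0 b)
          | length-++ (filterB (between b x) (interval (suc b) t)) {filterB (between b x) (interval 0 b)}
          | length-filterB-interval (between b x) (suc b) t m
              (λ j j<t → trans (cong (_∧ (suc b + j <ᵇ x)) (<ᵇ-true {b} {suc b + j} (s≤s (m≤m+n b j)))) (legs j j<t))
          | length-filterB-none (between b x) (interval 0 b)
              (λ {c} c∈pad → cong (_∧ (c <ᵇ x)) (<ᵇ-false {b} {c} (<⇒≤ (proj₂ (∈-interval⁻ b c∈pad)))))
    = +-identityʳ _

  hookβ-leg-to-gap : ∀ a b t i → i < t → suc b + i < a →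
    map (replace (suc b + i) b) (hookβ a b t) ↭ hookβ a (suc b + i) (t ∸ suc i)
  hookβ-leg-to-gap a b t i i<t 1+b+i<a =
    subst₂ _↭_ (sym moved) (sym target) (prep a (++⁺ˡ upper (↭-sym (shift b lower pad))))
    where
    x = suc b + i
    k = t ∸ suc i
    upper = interval (suc b + suc i) k
    lower = interval (suc b) i
    pad = interval 0 b
    upper-fixed : map (replace x b) upper ≡ upper
    upper-fixed = map-id-local (All.tabulate (λ c∈ → replace-miss (λ c≡x →
      <-irrefl (sym c≡x) (<-≤-trans (+-monoʳ-< (suc b) ≤-refl) (proj₁ (∈-interval⁻ k c∈))))))
    lower-fixed : map (replace x b) lower ≡ lower
    lower-fixed = map-id-local (All.tabulate (λ c∈ → replace-miss (λ c≡x → <-irrefl c≡x (proj₂ (∈-interval⁻ i c∈)))))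
    pad-fixed : map (replace x b) pad ≡ pad
    pad-fixed = map-id-local (All.tabulate (λ c∈ → replace-miss (λ c≡x →
      <-irrefl c≡x (<-trans (proj₂ (∈-interval⁻ b c∈)) (s≤s (m≤m+n b i))))))
    leg-moved : map (replace x b) (interval (suc b) t) ≡ upper ++ (b ∷ lower)
    leg-moved = begin
      map (replace x b) (interval (suc b) t)                               ≡⟨ cong (map (replace x b) ∘ interval (suc b)) (sym (m∸n+n≡m i<t)) ⟩
      map (replace x b) (interval (suc b) (k + suc i))                     ≡⟨ cong (map (replace x b)) (interval-+ (suc b) (suc i) k) ⟩
      map (replace x b) (upper ++ x ∷ lower)                               ≡⟨ map-++ (replace x b) upper (x ∷ lower) ⟩
      map (replace x b) upper ++ replace x b x ∷ map (replace x b) lower   ≡⟨ cong₂ _++_ upper-fixed (cong₂ _∷_ (replace-hit x b) lower-fixed) ⟩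
      upper ++ b ∷ lower                                                   ∎
      where open ≡-Reasoning
    moved : map (replace x b) (hookβ a b t) ≡ a ∷ (upper ++ (b ∷ (lower ++ pad)))
    moved = cong₂ _∷_ (replace-miss (λ a≡x → <-irrefl (sym a≡x) 1+b+i<a))
      (trans (map-++ (replace x b) (interval (suc b) t) pad)
        (trans (cong₂ _++_ leg-moved pad-fixed) (++-assoc upper (b ∷ lower) pad)))
    target : hookβ a x k ≡ a ∷ (upper ++ (lower ++ (b ∷ pad)))
    target = cong (a ∷_) (cong₂ _++_ (cong (λ z → interval z k) (sym (+-suc (suc b) i)))
               (trans (cong (interval 0) (+-comm (suc b) i)) (interval-+ 0 (suc b) i)))

  -- Removing a rim hook of length 1 + i from the padded hook hookβ a b t: only the arm bead a
  -- and the leg bead b + 1 + i (which drops into the gap at b) can move.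
  module HookRimHooks (a b t i : ℕ) (μs : List ℕ) where

    β : List ℕ
    β = hookβ a b t

    move : ℕ → ℤ
    move = rimHookTerm (suc i) μs β

    private
      pad-vanishes : sumZ (map move (interval 0 b)) ≡ 0ℤ
      pad-vanishes = sumZ-map-zero move (interval 0 b) vanishes
        where
        vanishes : ∀ {x} → x ∈ interval 0 b → move x ≡ 0ℤ
        vanishes {x} x∈pad with x <? suc i
        ... | yes x<r = rimHookTerm-short (suc i) μs β x x<r
        ... | no _ = rimHookTerm-blocked (suc i) μs β x
                       (memB-hookβ-pad {a} {b} {t} (≤-<-trans (m∸n≤m x (suc i)) (proj₂ (∈-interval⁻ b x∈pad))))

      leg-sum : ∀ k → k ≤ t → sumZ (map move (interval (suc b) k)) ≡ (if i <ᵇ k then move (suc b + i) else 0ℤ)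
      leg-sum zero _ = refl
      leg-sum (suc k) k<t with <-cmp i k
      ... | tri≈ _ refl _ rewrite leg-sum k (<⇒≤ k<t) | <ᵇ-false {i} {i} ≤-refl | <ᵇ-true {i} {suc i} ≤-refl =
        ℤP.+-identityʳ _
      ... | tri< i<k _ _ rewrite leg-sum k (<⇒≤ k<t) | <ᵇ-true i<k | <ᵇ-true {i} {suc k} (m<n⇒m<1+n i<k) =
        trans (cong (ℤ._+ move (suc b + i)) (rimHookTerm-blocked (suc i) μs β (suc b + k) occupied)) (ℤP.+-identityˡ _)
        where
        occupied : memB (b + k ∸ i) β ≡ true
        occupied rewrite +-∸-assoc b (<⇒≤ i<k) =
          memB-hookβ-leg {a} {b} {t} (subst (_< b + (k ∸ i)) (+-identityʳ b) (+-monoʳ-< b (m<n⇒0<n∸m i<k)))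
                                     (+-monoʳ-≤ b (≤-trans (m∸n≤m k i) (<⇒≤ k<t)))
      ... | tri> _ _ k<i rewrite leg-sum k (<⇒≤ k<t) | <ᵇ-false {i} {k} (<⇒≤ k<i) | <ᵇ-false {i} {suc k} k<i =
        trans (ℤP.+-identityʳ _) vanishes
        where
        vanishes : move (suc b + k) ≡ 0ℤ
        vanishes with (suc b + k) <? suc i
        ... | yes short = rimHookTerm-short (suc i) μs β (suc b + k) short
        ... | no long = rimHookTerm-blocked (suc i) μs β (suc b + k) (memB-hookβ-pad {a} {b} {t} below-b)
          where
          below-b : b + k ∸ i < b
          below-b = +-cancelʳ-< i (b + k ∸ i) b
                      (subst (_< b + i) (sym (m∸n+n≡m (≤-pred (≮⇒≥ long)))) (+-monoʳ-< b k<i))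

    chiβ-hookβ : chiβ β (suc i ∷ μs) ≡ move a ℤ.+ (if i <ᵇ t then move (suc b + i) else 0ℤ)
    chiβ-hookβ = begin
      move a ℤ.+ sumZ (map move (leg ++ pad))
        ≡⟨ cong (λ z → move a ℤ.+ z) (trans (cong sumZ (map-++ move leg pad)) (sumZ-++ (map move leg) (map move pad))) ⟩
      move a ℤ.+ (sumZ (map move leg) ℤ.+ sumZ (map move pad))
        ≡⟨ cong₂ (λ x y → move a ℤ.+ (x ℤ.+ y)) (leg-sum t ≤-refl) pad-vanishes ⟩
      move a ℤ.+ ((if i <ᵇ t then move (suc b + i) else 0ℤ) ℤ.+ 0ℤ)
        ≡⟨ cong (λ z → move a ℤ.+ z) (ℤP.+-identityʳ _) ⟩
      move a ℤ.+ (if i <ᵇ t then move (suc b + i) else 0ℤ) ∎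
      where
      open ≡-Reasoning
      leg = interval (suc b) t
      pad = interval 0 b

    module _ (b+t<a : b + t < a) where

      private
        b<a : b < a
        b<a = ≤-<-trans (m≤m+n b t) b+t<a

      move-leg : i < t → move (suc b + i) ≡ sgn i ℤ.* chiβ (hookβ a (suc b + i) (t ∸ suc i)) μs
      move-leg i<t = begin
        move (suc b + i)
          ≡⟨ rimHookTerm-free (suc i) μs β (suc b + i) (s≤s (m≤n+m i b)) free ⟩
        sgn (length (filterB (between (b + i ∸ i) (suc b + i)) β)) ℤ.* chiβ (map (replace (suc b + i) (b + i ∸ i)) β) μs
          ≡⟨ cong (λ y → sgn (length (filterB (between y (suc b + i)) β)) ℤ.* chiβ (map (replace (suc b + i) y) β) μs)
                  (m+n∸n≡m b i) ⟩
        sgn (length (filterB (between b (suc b + i)) β)) ℤ.* chiβ (map (replace (suc b + i) b) β) μs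
          ≡⟨ cong₂ (λ n z → sgn n ℤ.* z) count (chiβ-↭ μs (hookβ-leg-to-gap a b t i i<t 1+b+i<a)) ⟩
        sgn i ℤ.* chiβ (hookβ a (suc b + i) (t ∸ suc i)) μs ∎
        where
        open ≡-Reasoning
        1+b+i<a : suc b + i < a
        1+b+i<a = ≤-trans (+-monoʳ-< (suc b) i<t) b+t<a
        free : memB (b + i ∸ i) β ≡ false
        free rewrite m+n∸n≡m b i = memB-hookβ-gap {a} {b} {t} (<⇒≢ b<a) (inj₁ refl)
        count : length (filterB (between b (suc b + i)) β) ≡ i
        count = trans (count-hookβ-between a b t (suc b + i) i (<⇒≤ 1+b+i<a) (λ j _ → +-<ᵇ-cancelˡ (suc b) j i))
                      (m≥n⇒m⊓n≡n (<⇒≤ i<t))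

      private
        rest : List ℕ
        rest = interval (suc b) t ++ interval 0 b

        rest-≤ : ∀ {c} → c ∈ rest → c ≤ b + t
        rest-≤ c∈ with ∈-++⁻ (interval (suc b) t) c∈
        ... | inj₁ c∈leg = ≤-pred (proj₂ (∈-interval⁻ t c∈leg))
        ... | inj₂ c∈pad = ≤-trans (<⇒≤ (proj₂ (∈-interval⁻ b c∈pad))) (m≤m+n b t)

        replace-arm : ∀ y → map (replace a y) β ≡ y ∷ rest
        replace-arm y = cong₂ _∷_ (replace-hit a y)
          (map-id-local (All.tabulate (λ c∈ → replace-miss (λ c≡a → <-irrefl c≡a (≤-<-trans (rest-≤ c∈) b+t<a)))))

      move-arm-shorter : suc i ≤ a → b + t < a ∸ suc i → move a ≡ chiβ (hookβ (a ∸ suc i) b t) μs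
      move-arm-shorter r≤a b+t<a-r = begin
        move a
          ≡⟨ rimHookTerm-free (suc i) μs β a r≤a free ⟩
        sgn (length (filterB (between (a ∸ suc i) a) β)) ℤ.* chiβ (map (replace a (a ∸ suc i)) β) μs
          ≡⟨ cong₂ (λ n z → sgn n ℤ.* chiβ z μs) count (replace-arm (a ∸ suc i)) ⟩
        1ℤ ℤ.* chiβ (hookβ (a ∸ suc i) b t) μs
          ≡⟨ ℤP.*-identityˡ _ ⟩
        chiβ (hookβ (a ∸ suc i) b t) μs ∎
        where
        open ≡-Reasoning
        free : memB (a ∸ suc i) β ≡ false
        free = memB-hookβ-gap {a} {b} {t} (<⇒≢ (∸-monoʳ-< {a} {suc i} {0} (s≤s z≤n) r≤a)) (inj₂ b+t<a-r)
        count : length (filterB (between (a ∸ suc i) a) β) ≡ 0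
        count = length-filterB-none (between (a ∸ suc i) a) β none
          where
          none : ∀ {c} → c ∈ β → between (a ∸ suc i) a c ≡ false
          none (here refl) rewrite <ᵇ-false {a} {a} ≤-refl = ∧-zeroʳ _
          none {c} (there c∈) rewrite <ᵇ-false {a ∸ suc i} {c} (≤-trans (rest-≤ c∈) (<⇒≤ b+t<a-r)) = refl

      move-arm-to-gap : suc i ≤ a → a ∸ suc i ≡ b → move a ≡ sgn t ℤ.* chiβ (hookβ b b t) μs
      move-arm-to-gap r≤a a-r≡b = begin
        move a
          ≡⟨ rimHookTerm-free (suc i) μs β a r≤a free ⟩
        sgn (length (filterB (between (a ∸ suc i) a) β)) ℤ.* chiβ (map (replace a (a ∸ suc i)) β) μs
          ≡⟨ cong₂ (λ n z → sgn n ℤ.* chiβ z μs) count (replace-arm (a ∸ suc i)) ⟩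
        sgn t ℤ.* chiβ ((a ∸ suc i) ∷ rest) μs
          ≡⟨ cong (λ y → sgn t ℤ.* chiβ (y ∷ rest) μs) a-r≡b ⟩
        sgn t ℤ.* chiβ (b ∷ rest) μs ∎
        where
        open ≡-Reasoning
        free : memB (a ∸ suc i) β ≡ false
        free rewrite a-r≡b = memB-hookβ-gap {a} {b} {t} (<⇒≢ b<a) (inj₁ refl)
        count : length (filterB (between (a ∸ suc i) a) β) ≡ t
        count rewrite a-r≡b =
          trans (count-hookβ-between a b t a t ≤-refl
                   (λ j j<t → trans (<ᵇ-true (≤-trans (+-monoʳ-< (suc b) j<t) b+t<a)) (sym (<ᵇ-true j<t))))
                (⊓-idem t)

      move-arm-blocked : a ∸ suc i ≤ b + t → a ∸ suc i ≢ b → move a ≡ 0ℤ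
      move-arm-blocked a-r≤b+t a-r≢b with <-cmp (a ∸ suc i) b
      ... | tri< a-r<b _ _ = rimHookTerm-blocked (suc i) μs β a (memB-hookβ-pad {a} {b} {t} a-r<b)
      ... | tri≈ _ a-r≡b _ = ⊥-elim (a-r≢b a-r≡b)
      ... | tri> _ _ b<a-r = rimHookTerm-blocked (suc i) μs β a (memB-hookβ-leg {a} {b} {t} b<a-r a-r≤b+t)

  chiβ-hookβ-recurrence : ∀ b i m t μs → t < suc i + m →
    chiβ (hookβ (b + (suc i + m)) b t) (suc i ∷ μs) ≡
      (if t <ᵇ m then chiβ (hookβ (b + m) b t) μs else 0ℤ)
      ℤ.+ ((if m ≡ᵇ 0 then sgn t ℤ.* chiβ (hookβ b b t) μs else 0ℤ)
      ℤ.+ (if i <ᵇ t then sgn i ℤ.* chiβ (hookβ (b + (suc i + m)) (suc b + i) (t ∸ suc i)) μs else 0ℤ))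
  chiβ-hookβ-recurrence b i m t μs t<n =
    trans H.chiβ-hookβ (trans (cong₂ ℤ._+_ arm leg) (ℤP.+-assoc shorter to-gap leg-move))
    where
    a = b + (suc i + m)
    module H = HookRimHooks a b t i μs
    b+t<a : b + t < a
    b+t<a = +-monoʳ-< b t<n
    r≤a : suc i ≤ a
    r≤a = ≤-trans (m≤m+n (suc i) m) (m≤n+m (suc i + m) b)
    a-r≡b+m : a ∸ suc i ≡ b + m
    a-r≡b+m = trans (cong (_∸ suc i) (trans (cong (b +_) (+-comm (suc i) m)) (sym (+-assoc b m (suc i)))))
                    (m+n∸n≡m (b + m) (suc i))
    shorter = if t <ᵇ m then chiβ (hookβ (b + m) b t) μs else 0ℤ
    to-gap = if m ≡ᵇ 0 then sgn t ℤ.* chiβ (hookβ b b t) μs else 0ℤ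
    leg-move = if i <ᵇ t then sgn i ℤ.* chiβ (hookβ a (suc b + i) (t ∸ suc i)) μs else 0ℤ
    arm : H.move a ≡ shorter ℤ.+ to-gap
    arm with t <? m | m ≟ 0
    ... | yes t<m | _ rewrite <ᵇ-true t<m | ≡ᵇ-false {m} {0} (λ m≡0 → <⇒≱ t<m (subst (_≤ t) (sym m≡0) z≤n)) =
      trans (H.move-arm-shorter b+t<a r≤a (subst (b + t <_) (sym a-r≡b+m) (+-monoʳ-< b t<m)))
            (trans (cong (λ y → chiβ (hookβ y b t) μs) a-r≡b+m) (sym (ℤP.+-identityʳ _)))
    ... | no _ | yes refl rewrite ≡ᵇ-true {0} refl =
      trans (H.move-arm-to-gap b+t<a r≤a (trans a-r≡b+m (+-identityʳ b))) (sym (ℤP.+-identityˡ _))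
    ... | no t≮m | no m≢0 rewrite <ᵇ-false {t} {m} (≮⇒≥ t≮m) | ≡ᵇ-false {m} {0} m≢0 =
      H.move-arm-blocked b+t<a (subst (_≤ b + t) (sym a-r≡b+m) (+-monoʳ-≤ b (≮⇒≥ t≮m)))
        (λ a-r≡b → m≢0 (+-cancelˡ-≡ b m 0 (trans (trans (sym a-r≡b+m) a-r≡b) (sym (+-identityʳ b)))))
    leg : (if i <ᵇ t then H.move (suc b + i) else 0ℤ) ≡ leg-move
    leg with i <? t
    ... | yes i<t rewrite <ᵇ-true i<t = H.move-leg b+t<a i<t
    ... | no i≮t rewrite <ᵇ-false {i} {t} (≮⇒≥ i≮t) = refl

  sumBelow : ℕ → (ℕ → ℤ) → ℤ
  sumBelow zero f = 0ℤ
  sumBelow (suc m) f = f 0 ℤ.+ sumBelow m (f ∘ suc)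

  sumBelow-cong : ∀ m {f g : ℕ → ℤ} → (∀ t → t < m → f t ≡ g t) → sumBelow m f ≡ sumBelow m g
  sumBelow-cong zero _ = refl
  sumBelow-cong (suc m) f≡g = cong₂ ℤ._+_ (f≡g 0 z<s) (sumBelow-cong m (λ t t<m → f≡g (suc t) (s≤s t<m)))

  sumBelow-+ : ∀ m (f g : ℕ → ℤ) → sumBelow m (λ t → f t ℤ.+ g t) ≡ sumBelow m f ℤ.+ sumBelow m g
  sumBelow-+ zero f g = refl
  sumBelow-+ (suc m) f g =
    trans (cong (λ z → f 0 ℤ.+ g 0 ℤ.+ z) (sumBelow-+ m (f ∘ suc) (g ∘ suc)))
          (interchange (f 0) (g 0) (sumBelow m (f ∘ suc)) (sumBelow m (g ∘ suc)))
    where open import Algebra.Properties.CommutativeSemigroup ℤP.+-commutativeSemigroup using (interchange)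

  sumBelow-zero : ∀ m (f : ℕ → ℤ) → (∀ t → t < m → f t ≡ 0ℤ) → sumBelow m f ≡ 0ℤ
  sumBelow-zero zero f _ = refl
  sumBelow-zero (suc m) f f≡0 rewrite f≡0 0 z<s | sumBelow-zero m (f ∘ suc) (λ t t<m → f≡0 (suc t) (s≤s t<m)) = refl

  sumBelow-neg : ∀ m (f : ℕ → ℤ) → sumBelow m (ℤ.-_ ∘ f) ≡ ℤ.- sumBelow m f
  sumBelow-neg zero f = refl
  sumBelow-neg (suc m) f rewrite sumBelow-neg m (f ∘ suc) = sym (ℤP.neg-distrib-+ (f 0) _)

  sumBelow-truncate : ∀ k m (f : ℕ → ℤ) → k ≤ m → sumBelow m (λ t → if t <ᵇ k then f t else 0ℤ) ≡ sumBelow k f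
  sumBelow-truncate zero m f _ = sumBelow-zero m _ (λ _ _ → refl)
  sumBelow-truncate (suc k) (suc m) f (s≤s k≤m) = cong (λ z → f 0 ℤ.+ z) (sumBelow-truncate k m (f ∘ suc) k≤m)

  sumBelow-shift : ∀ i m (f : ℕ → ℤ) → sumBelow (suc i + m) (λ t → if i <ᵇ t then f t else 0ℤ) ≡ sumBelow m (λ u → f (suc i + u))
  sumBelow-shift zero m f = ℤP.+-identityˡ _
  sumBelow-shift (suc i) m f = trans (ℤP.+-identityˡ _) (sumBelow-shift i m (f ∘ suc))

  sumBelow-telescope : ∀ m (φ : ℕ → ℤ) → sumBelow m (λ t → φ t ℤ.- φ (suc t)) ≡ φ 0 ℤ.- φ m
  sumBelow-telescope zero φ = sym (ℤP.+-inverseʳ (φ 0))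
  sumBelow-telescope (suc m) φ rewrite sumBelow-telescope m (φ ∘ suc) = begin
    (φ 0 ℤ.- φ 1) ℤ.+ (φ 1 ℤ.- φ (suc m))   ≡⟨ ℤP.+-assoc (φ 0) (ℤ.- φ 1) _ ⟩
    φ 0 ℤ.+ (ℤ.- φ 1 ℤ.+ (φ 1 ℤ.- φ (suc m))) ≡⟨ cong (λ z → φ 0 ℤ.+ z) (sym (ℤP.+-assoc (ℤ.- φ 1) (φ 1) _)) ⟩
    φ 0 ℤ.+ ((ℤ.- φ 1 ℤ.+ φ 1) ℤ.- φ (suc m)) ≡⟨ cong (λ z → φ 0 ℤ.+ (z ℤ.- φ (suc m))) (ℤP.+-inverseˡ (φ 1)) ⟩
    φ 0 ℤ.+ (0ℤ ℤ.- φ (suc m))                ≡⟨ cong (λ z → φ 0 ℤ.+ z) (ℤP.+-identityˡ _) ⟩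
    φ 0 ℤ.- φ (suc m)                         ∎
    where open ≡-Reasoning

  sumBelow-snoc : ∀ n (f : ℕ → ℤ) → sumBelow (suc n) f ≡ sumBelow n f ℤ.+ f n
  sumBelow-snoc zero f = ℤP.+-comm (f 0) 0ℤ
  sumBelow-snoc (suc n) f = trans (cong (λ z → f 0 ℤ.+ z) (sumBelow-snoc n (f ∘ suc))) (sym (ℤP.+-assoc (f 0) _ _))

  sumBelow-reverse : ∀ n (f : ℕ → ℤ) → sumBelow n f ≡ sumBelow n (λ t → f (n ∸ suc t))
  sumBelow-reverse zero f = refl
  sumBelow-reverse (suc n) f = begin
    f 0 ℤ.+ sumBelow n (f ∘ suc)                        ≡⟨ cong (λ z → f 0 ℤ.+ z) (sumBelow-reverse n (f ∘ suc)) ⟩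
    f 0 ℤ.+ sumBelow n (λ t → f (suc (n ∸ suc t)))      ≡⟨ cong (λ z → f 0 ℤ.+ z) (sumBelow-cong n (λ t t<n → cong f (sym (+-∸-assoc 1 t<n)))) ⟩
    f 0 ℤ.+ sumBelow n (λ t → f (suc n ∸ suc t))        ≡⟨ ℤP.+-comm (f 0) _ ⟩
    sumBelow n (λ t → f (suc n ∸ suc t)) ℤ.+ f 0        ≡⟨ cong (λ k → sumBelow n (λ t → f (suc n ∸ suc t)) ℤ.+ f k) (n∸n≡0 n) ⟨
    sumBelow n (λ t → f (suc n ∸ suc t)) ℤ.+ f (n ∸ n)  ≡⟨ sumBelow-snoc n (λ t → f (suc n ∸ suc t)) ⟨
    sumBelow (suc n) (λ t → f (suc n ∸ suc t))          ∎
    where open ≡-Reasoning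

  sumZ-applyUpTo : ∀ n (g : ℕ → ℤ) (f : ℕ → ℕ) → sumZ (map g (applyUpTo f n)) ≡ sumBelow n (g ∘ f)
  sumZ-applyUpTo zero g f = refl
  sumZ-applyUpTo (suc n) g f = cong (λ z → g (f 0) ℤ.+ z) (sumZ-applyUpTo n g (f ∘ suc))

  sumZ-map-suc-upTo : ∀ n (g : ℕ → ℤ) → sumZ (map g (map suc (upTo n))) ≡ sumBelow n (λ t → g (n ∸ t))
  sumZ-map-suc-upTo n g = begin
    sumZ (map g (map suc (upTo n)))          ≡⟨ cong sumZ (map-∘ (upTo n)) ⟨
    sumZ (map (g ∘ suc) (upTo n))            ≡⟨ sumZ-applyUpTo n (g ∘ suc) (λ t → t) ⟩
    sumBelow n (g ∘ suc)                     ≡⟨ sumBelow-reverse n (g ∘ suc) ⟩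
    sumBelow n (λ t → g (suc (n ∸ suc t)))   ≡⟨ sumBelow-cong n (λ t t<n → cong g (sym (+-∸-assoc 1 t<n))) ⟩
    sumBelow n (λ t → g (n ∸ t))             ∎
    where open ≡-Reasoning

  -- Σ over sub-multisets S of D of (-1)^|S| φ(Σ S).
  signedSubsetSum : List ℕ → (ℕ → ℤ) → ℤ
  signedSubsetSum [] φ = φ 0
  signedSubsetSum (r ∷ D) φ = signedSubsetSum D φ ℤ.- signedSubsetSum D (λ s → φ (r + s))

  signedSubsetSum-cong : ∀ D {φ ψ : ℕ → ℤ} → (∀ s → φ s ≡ ψ s) → signedSubsetSum D φ ≡ signedSubsetSum D ψ
  signedSubsetSum-cong [] φ≡ψ = φ≡ψ 0
  signedSubsetSum-cong (r ∷ D) φ≡ψ = cong₂ ℤ._-_ (signedSubsetSum-cong D φ≡ψ) (signedSubsetSum-cong D (φ≡ψ ∘ (r +_)))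

  signedSubsetSum-↭ : ∀ {D D′} → D ↭ D′ → ∀ φ → signedSubsetSum D φ ≡ signedSubsetSum D′ φ
  signedSubsetSum-↭ ↭-refl φ = refl
  signedSubsetSum-↭ (prep r D↭D′) φ = cong₂ ℤ._-_ (signedSubsetSum-↭ D↭D′ φ) (signedSubsetSum-↭ D↭D′ _)
  signedSubsetSum-↭ {x ∷ y ∷ D} {y ∷ x ∷ D′} (swap x y D↭D′) φ = begin
    (S φ ℤ.- S (φ ∘ (y +_))) ℤ.- (S (φ ∘ (x +_)) ℤ.- S (λ s → φ (x + (y + s))))
      ≡⟨ cong₂ ℤ._-_ (cong₂ ℤ._-_ (signedSubsetSum-↭ D↭D′ φ) (signedSubsetSum-↭ D↭D′ _))
                     (cong₂ ℤ._-_ (signedSubsetSum-↭ D↭D′ _) (signedSubsetSum-↭ D↭D′ _)) ⟩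
    (S′ φ ℤ.- S′ (φ ∘ (y +_))) ℤ.- (S′ (φ ∘ (x +_)) ℤ.- S′ (λ s → φ (x + (y + s))))
      ≡⟨ solve 4 (λ a b c d → (a :- b) :- (c :- d) := (a :- c) :- (b :- d)) refl
               (S′ φ) (S′ (φ ∘ (y +_))) (S′ (φ ∘ (x +_))) (S′ (λ s → φ (x + (y + s)))) ⟩
    (S′ φ ℤ.- S′ (φ ∘ (x +_))) ℤ.- (S′ (φ ∘ (y +_)) ℤ.- S′ (λ s → φ (x + (y + s))))
      ≡⟨ cong (λ z → (S′ φ ℤ.- S′ (φ ∘ (x +_))) ℤ.- (S′ (φ ∘ (y +_)) ℤ.- z))
              (signedSubsetSum-cong D′ (λ s → cong φ (x+[y+s]≡y+[x+s] s))) ⟩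
    (S′ φ ℤ.- S′ (φ ∘ (x +_))) ℤ.- (S′ (φ ∘ (y +_)) ℤ.- S′ (λ s → φ (y + (x + s)))) ∎
    where
    open ≡-Reasoning
    open import Data.Integer.Solver using (module +-*-Solver)
    open +-*-Solver
    S = signedSubsetSum D
    S′ = signedSubsetSum D′
    x+[y+s]≡y+[x+s] : ∀ s → x + (y + s) ≡ y + (x + s)
    x+[y+s]≡y+[x+s] s = trans (sym (+-assoc x y s)) (trans (cong (_+ s) (+-comm x y)) (+-assoc y x s))
  signedSubsetSum-↭ (↭-trans D↭D′ D′↭D″) φ = trans (signedSubsetSum-↭ D↭D′ φ) (signedSubsetSum-↭ D′↭D″ φ)

  sumZ-sublists : {A : Set} (w : A → ℕ) (xs : List A) (φ : ℕ → ℤ) →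
    sumZ (map (λ S → sgn (length S) ℤ.* φ (sum (map w S))) (sublists xs)) ≡ signedSubsetSum (map w xs) φ
  sumZ-sublists w [] φ = trans (ℤP.+-identityʳ _) (ℤP.*-identityˡ _)
  sumZ-sublists w (x ∷ xs) φ = begin
    sumZ (map term (sublists xs ++ map (x ∷_) (sublists xs)))
      ≡⟨ trans (cong sumZ (map-++ term (sublists xs) _)) (sumZ-++ (map term (sublists xs)) _) ⟩
    sumZ (map term (sublists xs)) ℤ.+ sumZ (map term (map (x ∷_) (sublists xs)))
      ≡⟨ cong₂ ℤ._+_ (sumZ-sublists w xs φ) (cong sumZ (sym (map-∘ (sublists xs)))) ⟩
    signedSubsetSum (map w xs) φ ℤ.+ sumZ (map (term ∘ (x ∷_)) (sublists xs))
      ≡⟨ cong (λ z → signedSubsetSum (map w xs) φ ℤ.+ z)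
              (trans (sumZ-map-cong (term ∘ (x ∷_)) (ℤ.-_ ∘ term′) (sublists xs)
                       (λ {S} _ → sym (ℤP.neg-distribˡ-* (sgn (length S)) (φ (w x + sum (map w S))))))
                     (sumZ-map-neg term′ (sublists xs))) ⟩
    signedSubsetSum (map w xs) φ ℤ.- sumZ (map term′ (sublists xs))
      ≡⟨ cong (λ z → signedSubsetSum (map w xs) φ ℤ.- z) (sumZ-sublists w xs (φ ∘ (w x +_))) ⟩
    signedSubsetSum (map w xs) φ ℤ.- signedSubsetSum (map w xs) (φ ∘ (w x +_)) ∎
    where
    open ≡-Reasoning
    term term′ : List _ → ℤ
    term S = sgn (length S) ℤ.* φ (sum (map w S))
    term′ S = sgn (length S) ℤ.* φ (w x + sum (map w S))

  sgn-+ : ∀ m n → sgn (m + n) ≡ sgn m ℤ.* sgn n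
  sgn-+ zero n = sym (ℤP.*-identityˡ _)
  sgn-+ (suc m) n = trans (cong ℤ.-_ (sgn-+ m n)) (ℤP.neg-distribˡ-* (sgn m) (sgn n))

  sgn-square : ∀ t → sgn t ℤ.* sgn t ≡ 1ℤ
  sgn-square zero = refl
  sgn-square (suc t) = begin
    ℤ.- sgn t ℤ.* ℤ.- sgn t       ≡⟨ ℤP.neg-distribˡ-* (sgn t) (ℤ.- sgn t) ⟨
    ℤ.- (sgn t ℤ.* ℤ.- sgn t)     ≡⟨ cong ℤ.-_ (ℤP.neg-distribʳ-* (sgn t) (sgn t)) ⟨
    ℤ.- ℤ.- (sgn t ℤ.* sgn t)     ≡⟨ ℤP.neg-involutive _ ⟩
    sgn t ℤ.* sgn t               ≡⟨ sgn-square t ⟩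
    1ℤ                            ∎
    where open ≡-Reasoning

  -- hookβ b b t = {0, …, b + t} is a β-set of the empty partition.
  chiβ-hookβ-empty : ∀ b t → chiβ (hookβ b b t) [] ≡ 1ℤ
  chiβ-hookβ-empty b t = cong (λ z → if z then 1ℤ else 0ℤ)
    (T⇒≡true (all⁻ (_<ᵇ length (hookβ b b t)) (All.tabulate (λ c∈ → <⇒<ᵇ (below (∈-hookβ⁻ c∈))))))
    where
    size : length (hookβ b b t) ≡ suc (t + b)
    size = cong suc (trans (length-++ (interval (suc b) t)) (cong₂ _+_ (length-interval (suc b) t) (length-interval 0 b)))
    below : ∀ {c} → (c ≡ b ⊎ (b < c × c ≤ b + t) ⊎ c < b) → c < length (hookβ b b t)
    below {c} c-cases rewrite size = s≤s (bound c-cases)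
      where
      bound : (c ≡ b ⊎ (b < c × c ≤ b + t) ⊎ c < b) → c ≤ t + b
      bound (inj₁ refl) = m≤n+m c t
      bound (inj₂ (inj₁ (_ , c≤b+t))) = subst (c ≤_) (+-comm b t) c≤b+t
      bound (inj₂ (inj₂ c<b)) = ≤-trans (<⇒≤ c<b) (m≤n+m b t)

  if-then-0 : ∀ (f : ℤ → ℤ) b x → f 0ℤ ≡ 0ℤ → f (if b then x else 0ℤ) ≡ (if b then f x else 0ℤ)
  if-then-0 f true x _ = refl
  if-then-0 f false x f0≡0 = f0≡0

  sgn-cancel : ∀ s u C D → s ℤ.* s ≡ 1ℤ → ℤ.- (s ℤ.* u) ℤ.* (s ℤ.* C) ℤ.* D ≡ ℤ.- (u ℤ.* C ℤ.* D)
  sgn-cancel s u C D s²≡1 = begin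
    ℤ.- (s ℤ.* u) ℤ.* (s ℤ.* C) ℤ.* D   ≡⟨ solve 4 (λ s u C D → :- (s :* u) :* (s :* C) :* D := :- ((s :* s) :* (u :* C :* D))) refl s u C D ⟩
    ℤ.- ((s ℤ.* s) ℤ.* (u ℤ.* C ℤ.* D)) ≡⟨ cong (λ z → ℤ.- (z ℤ.* (u ℤ.* C ℤ.* D))) s²≡1 ⟩
    ℤ.- (1ℤ ℤ.* (u ℤ.* C ℤ.* D))        ≡⟨ cong ℤ.-_ (ℤP.*-identityˡ _) ⟩
    ℤ.- (u ℤ.* C ℤ.* D)                  ∎
    where
    open ≡-Reasoning
    open import Data.Integer.Solver using (module +-*-Solver)
    open +-*-Solver

  legTerm : ℕ → List ℕ → (ℕ → ℤ) → ℕ → ℤ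
  legTerm b μ φ t = sgn t ℤ.* chiβ (hookβ (b + sum μ) b t) μ ℤ.* (φ t ℤ.- φ (suc t))

  legMove : ℕ → ℕ → List ℕ → (ℕ → ℤ) → ℕ → ℤ
  legMove b i μ φ t = sgn t ℤ.* (sgn i ℤ.* chiβ (hookβ (b + (suc i + sum μ)) (suc b + i) (t ∸ suc i)) μ) ℤ.* (φ t ℤ.- φ (suc t))

  legTerm-split : ∀ b i μ φ t → sum μ ≢ 0 → t < suc i + sum μ →
    legTerm b (suc i ∷ μ) φ t ≡ (if t <ᵇ sum μ then legTerm b μ φ t else 0ℤ) ℤ.+ (if i <ᵇ t then legMove b i μ φ t else 0ℤ)
  legTerm-split b i μ φ t m≢0 t<n rewrite chiβ-hookβ-recurrence b i (sum μ) t μ t<n | ≡ᵇ-false {sum μ} {0} m≢0 = begin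
    s ℤ.* (A ℤ.+ (0ℤ ℤ.+ C)) ℤ.* D        ≡⟨ cong (λ z → s ℤ.* (A ℤ.+ z) ℤ.* D) (ℤP.+-identityˡ C) ⟩
    s ℤ.* (A ℤ.+ C) ℤ.* D                 ≡⟨ cong (ℤ._* D) (ℤP.*-distribˡ-+ s A C) ⟩
    (s ℤ.* A ℤ.+ s ℤ.* C) ℤ.* D           ≡⟨ ℤP.*-distribʳ-+ D (s ℤ.* A) (s ℤ.* C) ⟩
    s ℤ.* A ℤ.* D ℤ.+ s ℤ.* C ℤ.* D       ≡⟨ cong₂ ℤ._+_ (if-then-0 scale (t <ᵇ sum μ) _ scale-0) (if-then-0 scale (i <ᵇ t) _ scale-0) ⟩
    _                                     ∎
    where
    open ≡-Reasoning
    s = sgn t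
    D = φ t ℤ.- φ (suc t)
    A = if t <ᵇ sum μ then chiβ (hookβ (b + sum μ) b t) μ else 0ℤ
    C = if i <ᵇ t then sgn i ℤ.* chiβ (hookβ (b + (suc i + sum μ)) (suc b + i) (t ∸ suc i)) μ else 0ℤ
    scale : ℤ → ℤ
    scale x = s ℤ.* x ℤ.* D
    scale-0 : scale 0ℤ ≡ 0ℤ
    scale-0 = trans (cong (ℤ._* D) (ℤP.*-zeroʳ s)) (ℤP.*-zeroˡ D)

  legMove-shift : ∀ b i μ φ u → legMove b i μ φ (suc i + u) ≡ ℤ.- legTerm (suc b + i) μ (φ ∘ (suc i +_)) u
  legMove-shift b i μ φ u
    rewrite m+n∸m≡n (suc i) u | sgn-+ i u | +-suc (suc i) u | +-suc b (i + sum μ) | +-assoc b i (sum μ)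
    = sgn-cancel (sgn i) (sgn u) _ _ (sgn-square i)

  -- Removing the first part 1 + i of μ either shortens the arm, which gives the sum for the rest of μ,
  -- or drops a leg bead into the gap, which gives minus that sum with φ shifted by 1 + i.
  sumBelow-legTerm : ∀ μ → All (1 ≤_) μ → μ ≢ [] → ∀ b φ → sumBelow (sum μ) (legTerm b μ φ) ≡ signedSubsetSum μ φ
  sumBelow-legTerm [] _ []≢[] = ⊥-elim ([]≢[] refl)
  sumBelow-legTerm (zero ∷ _) (() ∷ _) _
  sumBelow-legTerm (suc i ∷ []) _ _ b φ =
    trans (sumBelow-cong (suc i + 0) single) (sumBelow-telescope (suc i + 0) φ)
    where
    single : ∀ t → t < suc i + 0 → legTerm b (suc i ∷ []) φ t ≡ φ t ℤ.- φ (suc t)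
    single t t<n
      rewrite chiβ-hookβ-recurrence b i 0 t [] t<n
            | <ᵇ-false {i} {t} (≤-pred (subst (t <_) (+-identityʳ (suc i)) t<n))
            | chiβ-hookβ-empty b t
            | ℤP.*-identityʳ (sgn t) | ℤP.+-identityʳ (sgn t) | ℤP.+-identityˡ (sgn t) | sgn-square t
      = ℤP.*-identityˡ _
  sumBelow-legTerm (suc i ∷ μ@(r ∷ μ′)) (_ ∷ μ⁺@(1≤r ∷ _)) _ b φ = begin
    sumBelow n (legTerm b (suc i ∷ μ) φ)
      ≡⟨ sumBelow-cong n (λ t → legTerm-split b i μ φ t m≢0) ⟩
    sumBelow n (λ t → shorter t ℤ.+ moved t)
      ≡⟨ sumBelow-+ n shorter moved ⟩
    sumBelow n shorter ℤ.+ sumBelow n moved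
      ≡⟨ cong₂ ℤ._+_ (sumBelow-truncate m n (legTerm b μ φ) (m≤n+m m (suc i))) (sumBelow-shift i m (legMove b i μ φ)) ⟩
    sumBelow m (legTerm b μ φ) ℤ.+ sumBelow m (λ u → legMove b i μ φ (suc i + u))
      ≡⟨ cong (λ z → sumBelow m (legTerm b μ φ) ℤ.+ z)
              (trans (sumBelow-cong m (λ u _ → legMove-shift b i μ φ u)) (sumBelow-neg m _)) ⟩
    sumBelow m (legTerm b μ φ) ℤ.- sumBelow m (legTerm (suc b + i) μ φ′)
      ≡⟨ cong₂ ℤ._-_ (sumBelow-legTerm μ μ⁺ (λ ()) b φ) (sumBelow-legTerm μ μ⁺ (λ ()) (suc b + i) φ′) ⟩
    signedSubsetSum μ φ ℤ.- signedSubsetSum μ φ′ ∎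
    where
    open ≡-Reasoning
    m = sum μ
    n = suc i + m
    φ′ : ℕ → ℤ
    φ′ = φ ∘ (suc i +_)
    shorter moved : ℕ → ℤ
    shorter t = if t <ᵇ m then legTerm b μ φ t else 0ℤ
    moved t = if i <ᵇ t then legMove b i μ φ t else 0ℤ
    m≢0 : m ≢ 0
    m≢0 m≡0 = <⇒≢ (≤-trans 1≤r (m≤m+n r (sum μ′))) (sym m≡0)

  beta-hook : ∀ n t → t ≤ n → beta (hook n (n ∸ t)) ≡ hookβ n 0 t
  beta-hook n t t≤n rewrite m∸[m∸n]≡n t≤n | length-replicate t {1} | m∸n+n≡m t≤n =
    cong (n ∷_) (trans (ones t) (sym (++-identityʳ (interval 1 t))))
    where
    ones : ∀ t → beta (replicate t 1) ≡ interval 1 t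
    ones zero = refl
    ones (suc t) = cong₂ _∷_ (cong suc (length-replicate t)) (ones t)

  χ-hook-expansion : ∀ n D → sum D ≡ n → All (1 ≤_) D → D ≢ [] → (φ : ℕ → ℤ) →
    sumBelow n (λ t → sgn t ℤ.* (φ t ℤ.- φ (suc t)) ℤ.* χ (hook n (n ∸ t)) D) ≡ signedSubsetSum D φ
  χ-hook-expansion .(sum D) D refl D⁺ D≢[] φ = trans (sumBelow-cong (sum D) hook-is-leg) (sumBelow-legTerm D D⁺ D≢[] 0 φ)
    where
    hook-is-leg : ∀ t → t < sum D → sgn t ℤ.* (φ t ℤ.- φ (suc t)) ℤ.* χ (hook (sum D) (sum D ∸ t)) D ≡ legTerm 0 D φ t
    hook-is-leg t t<n rewrite beta-hook (sum D) t (<⇒≤ t<n) = xy∙z≈xz∙y (sgn t) _ _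
      where open import Algebra.Properties.CommutativeSemigroup ℤP.*-commutativeSemigroup using (xy∙z≈xz∙y)

module MonicPolynomials (F : FiniteField) where

  open import Algebra.Bundles using (CommutativeRing)
  open import Algebra.Structures using (IsCommutativeRing)
  import Algebra.Solver.Ring.NaturalCoefficients.Default as Solver
  open import Data.Empty using (⊥-elim)
  open import Data.List using ([]; _∷_; map; length)
  open import Data.List.Properties using (length-map)
  open import Data.Nat as ℕ using (ℕ; zero; suc; _≤_; _<_; z≤n; s≤s)
  import Data.Nat.Properties as ℕP
  open import Data.Product using (Σ; _×_; _,_; proj₁; proj₂)
  open import Data.Sum using (_⊎_; inj₁; inj₂)
  open import Data.Vec using ([]; _∷_)
  open import Level using (0ℓ)
  open import Relation.Binary.Definitions using (tri<; tri≈; tri>)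
  open import Relation.Binary.PropositionalEquality
  open import Relation.Nullary using (¬_; yes; no)

  open FiniteField F renaming (_+_ to infixl 6 _+_; _*_ to infixl 7 _*_; -_ to infix 8 -_)
  open IsCommutativeRing isCommutativeRing
    using (+-assoc; +-comm; +-identityˡ; +-identityʳ; *-assoc; *-comm; *-identityˡ; *-identityʳ;
           distribˡ; distribʳ; zeroˡ; zeroʳ; -‿inverseˡ)

  ring : CommutativeRing 0ℓ 0ℓ
  ring = record { isCommutativeRing = isCommutativeRing }

  open Solver (CommutativeRing.commutativeSemiring ring) using (solve; _:+_; _:*_; _:=_)

  coeff : Poly F → ℕ → Carrier
  coeff [] k = 0#
  coeff (a ∷ p) zero = a
  coeff (a ∷ p) (suc k) = coeff p k

  -- Coefficient lists are equal as polynomials when they differ only by trailing zeros.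
  infix 4 _≈_
  record _≈_ (p q : Poly F) : Set where
    constructor mk≈
    field at : ∀ k → coeff p k ≡ coeff q k
  open _≈_

  ≈-refl : ∀ {p} → p ≈ p
  ≈-refl = mk≈ (λ _ → refl)

  ≈-sym : ∀ {p q} → p ≈ q → q ≈ p
  ≈-sym p≈q = mk≈ (λ k → sym (at p≈q k))

  ≈-trans : ∀ {p q r} → p ≈ q → q ≈ r → p ≈ r
  ≈-trans p≈q q≈r = mk≈ (λ k → trans (at p≈q k) (at q≈r k))

  ≡⇒≈ : ∀ {p q} → p ≡ q → p ≈ q
  ≡⇒≈ refl = ≈-refl

  ≈-tail : ∀ {a b p q} → (a ∷ p) ≈ (b ∷ q) → p ≈ q
  ≈-tail a∷p≈b∷q = mk≈ (λ k → at a∷p≈b∷q (suc k))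

  ≈[]-tail : ∀ {a p} → (a ∷ p) ≈ [] → p ≈ []
  ≈[]-tail a∷p≈0 = mk≈ (λ k → at a∷p≈0 (suc k))

  scale : Carrier → Poly F → Poly F
  scale a = map (a *_)

  coeff-addP : ∀ p q k → coeff (addP F p q) k ≡ coeff p k + coeff q k
  coeff-addP [] q k = sym (+-identityˡ _)
  coeff-addP (a ∷ p) [] k = sym (+-identityʳ _)
  coeff-addP (a ∷ p) (b ∷ q) zero = refl
  coeff-addP (a ∷ p) (b ∷ q) (suc k) = coeff-addP p q k

  coeff-scale : ∀ a q k → coeff (scale a q) k ≡ a * coeff q k
  coeff-scale a [] k = sym (zeroʳ a)
  coeff-scale a (b ∷ q) zero = refl
  coeff-scale a (b ∷ q) (suc k) = coeff-scale a q k

  coeff-mulP : ∀ a p q k → coeff (mulP F (a ∷ p) q) k ≡ a * coeff q k + coeff (0# ∷ mulP F p q) k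
  coeff-mulP a p q k =
    trans (coeff-addP (scale a q) (0# ∷ mulP F p q) k) (cong (_+ coeff (0# ∷ mulP F p q) k) (coeff-scale a q k))

  addP-cong : ∀ {p p′ q q′} → p ≈ p′ → q ≈ q′ → addP F p q ≈ addP F p′ q′
  addP-cong {p} {p′} {q} {q′} p≈p′ q≈q′ =
    mk≈ (λ k → trans (coeff-addP p q k) (trans (cong₂ _+_ (at p≈p′ k) (at q≈q′ k)) (sym (coeff-addP p′ q′ k))))

  mulP-zeroˡ : ∀ p q → p ≈ [] → mulP F p q ≈ []
  mulP-zeroˡ p q p≈0 = mk≈ (go p p≈0)
    where
    go : ∀ p → p ≈ [] → ∀ k → coeff (mulP F p q) k ≡ 0#
    go [] _ k = refl
    go (a ∷ p) a∷p≈0 zero =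
      trans (coeff-mulP a p q zero) (trans (cong (λ z → z * coeff q zero + 0#) (at a∷p≈0 zero)) (trans (+-identityʳ _) (zeroˡ _)))
    go (a ∷ p) a∷p≈0 (suc k) =
      trans (coeff-mulP a p q (suc k))
        (trans (cong₂ (λ z w → z * coeff q (suc k) + w) (at a∷p≈0 zero) (go p (≈[]-tail a∷p≈0) k))
          (trans (+-identityʳ _) (zeroˡ _)))

  mulP-congˡ : ∀ {p p′} q → p ≈ p′ → mulP F p q ≈ mulP F p′ q
  mulP-congˡ {p} {p′} q p≈p′ = mk≈ (go p p′ p≈p′)
    where
    go : ∀ p p′ → p ≈ p′ → ∀ k → coeff (mulP F p q) k ≡ coeff (mulP F p′ q) k
    go [] p′ p≈p′ k = sym (at (mulP-zeroˡ p′ q (≈-sym p≈p′)) k)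
    go (a ∷ p) [] p≈p′ k = at (mulP-zeroˡ (a ∷ p) q p≈p′) k
    go (a ∷ p) (a′ ∷ p′) p≈p′ zero =
      trans (coeff-mulP a p q zero) (trans (cong (λ z → z * coeff q zero + 0#) (at p≈p′ zero)) (sym (coeff-mulP a′ p′ q zero)))
    go (a ∷ p) (a′ ∷ p′) p≈p′ (suc k) =
      trans (coeff-mulP a p q (suc k))
        (trans (cong₂ (λ z w → z * coeff q (suc k) + w) (at p≈p′ zero) (go p p′ (≈-tail p≈p′) k))
          (sym (coeff-mulP a′ p′ q (suc k))))

  mulP-congʳ : ∀ p {q q′} → q ≈ q′ → mulP F p q ≈ mulP F p q′
  mulP-congʳ p {q} {q′} q≈q′ = mk≈ (go p)
    where
    go : ∀ p k → coeff (mulP F p q) k ≡ coeff (mulP F p q′) k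
    go [] k = refl
    go (a ∷ p) zero =
      trans (coeff-mulP a p q zero) (trans (cong (λ z → a * z + 0#) (at q≈q′ zero)) (sym (coeff-mulP a p q′ zero)))
    go (a ∷ p) (suc k) =
      trans (coeff-mulP a p q (suc k))
        (trans (cong₂ (λ z w → a * z + w) (at q≈q′ (suc k)) (go p k)) (sym (coeff-mulP a p q′ (suc k))))

  mulP-zeroʳ : ∀ p → mulP F p [] ≈ []
  mulP-zeroʳ p = mk≈ (go p)
    where
    go : ∀ p k → coeff (mulP F p []) k ≡ 0#
    go [] k = refl
    go (a ∷ p) zero = trans (coeff-mulP a p [] zero) (trans (+-identityʳ _) (zeroʳ a))
    go (a ∷ p) (suc k) = trans (coeff-mulP a p [] (suc k)) (trans (cong₂ _+_ (zeroʳ a) (go p k)) (+-identityʳ _))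

  0∷-cong : ∀ {p q} → p ≈ q → (0# ∷ p) ≈ (0# ∷ q)
  0∷-cong p≈q = mk≈ (λ { zero → refl ; (suc k) → at p≈q k })

  mulP-∷ʳ : ∀ p b q → mulP F p (b ∷ q) ≈ addP F (scale b p) (0# ∷ mulP F p q)
  mulP-∷ʳ p b q = mk≈ (go p)
    where
    go : ∀ p k → coeff (mulP F p (b ∷ q)) k ≡ coeff (addP F (scale b p) (0# ∷ mulP F p q)) k
    go [] zero = refl
    go [] (suc k) = refl
    go (a ∷ p) zero =
      trans (coeff-mulP a p (b ∷ q) zero)
        (trans (cong (_+ 0#) (*-comm a b)) (sym (coeff-addP (scale b (a ∷ p)) (0# ∷ mulP F (a ∷ p) q) zero)))
    go (a ∷ p) (suc k) = begin
      coeff (mulP F (a ∷ p) (b ∷ q)) (suc k)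
        ≡⟨ coeff-mulP a p (b ∷ q) (suc k) ⟩
      a * coeff q k + coeff (mulP F p (b ∷ q)) k
        ≡⟨ cong (a * coeff q k +_) (trans (go p k) (coeff-addP (scale b p) (0# ∷ mulP F p q) k)) ⟩
      a * coeff q k + (coeff (scale b p) k + coeff (0# ∷ mulP F p q) k)
        ≡⟨ cong (λ z → a * coeff q k + (z + coeff (0# ∷ mulP F p q) k)) (coeff-scale b p k) ⟩
      a * coeff q k + (b * coeff p k + coeff (0# ∷ mulP F p q) k)
        ≡⟨ solve 3 (λ x y z → x :+ (y :+ z) := y :+ (x :+ z)) refl (a * coeff q k) (b * coeff p k) _ ⟩
      b * coeff p k + (a * coeff q k + coeff (0# ∷ mulP F p q) k)
        ≡⟨ cong₂ _+_ (coeff-scale b p k) (coeff-mulP a p q k) ⟨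
      coeff (scale b p) k + coeff (mulP F (a ∷ p) q) k
        ≡⟨ coeff-addP (scale b (a ∷ p)) (0# ∷ mulP F (a ∷ p) q) (suc k) ⟨
      coeff (addP F (scale b (a ∷ p)) (0# ∷ mulP F (a ∷ p) q)) (suc k) ∎
      where open ≡-Reasoning

  mulP-comm : ∀ p q → mulP F p q ≈ mulP F q p
  mulP-comm [] q = ≈-sym (mulP-zeroʳ q)
  mulP-comm (a ∷ p) q = ≈-sym (≈-trans (mulP-∷ʳ q a p) (addP-cong ≈-refl (0∷-cong (mulP-comm q p))))

  mulP-distribʳ : ∀ x y r → mulP F (addP F x y) r ≈ addP F (mulP F x r) (mulP F y r)
  mulP-distribʳ x y r = mk≈ (λ k → trans (go x y k) (sym (coeff-addP (mulP F x r) (mulP F y r) k)))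
    where
    interchange : ∀ a b c X Y → (a + b) * c + (X + Y) ≡ (a * c + X) + (b * c + Y)
    interchange = solve 5 (λ a b c X Y → (a :+ b) :* c :+ (X :+ Y) := (a :* c :+ X) :+ (b :* c :+ Y)) refl
    go : ∀ x y k → coeff (mulP F (addP F x y) r) k ≡ coeff (mulP F x r) k + coeff (mulP F y r) k
    go [] y k = sym (+-identityˡ _)
    go (a ∷ x) [] k = sym (+-identityʳ _)
    go (a ∷ x) (b ∷ y) zero =
      trans (coeff-mulP (a + b) (addP F x y) r zero)
        (trans (cong ((a + b) * coeff r zero +_) (sym (+-identityʳ 0#)))
          (trans (interchange a b (coeff r zero) 0# 0#) (sym (cong₂ _+_ (coeff-mulP a x r zero) (coeff-mulP b y r zero)))))
    go (a ∷ x) (b ∷ y) (suc k) =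
      trans (coeff-mulP (a + b) (addP F x y) r (suc k))
        (trans (cong ((a + b) * coeff r (suc k) +_) (go x y k))
          (trans (interchange a b (coeff r (suc k)) _ _) (sym (cong₂ _+_ (coeff-mulP a x r (suc k)) (coeff-mulP b y r (suc k))))))

  mulP-scaleˡ : ∀ a q r → mulP F (scale a q) r ≈ scale a (mulP F q r)
  mulP-scaleˡ a q r = mk≈ (λ k → trans (go q k) (sym (coeff-scale a (mulP F q r) k)))
    where
    go : ∀ q k → coeff (mulP F (scale a q) r) k ≡ a * coeff (mulP F q r) k
    go [] k = sym (zeroʳ a)
    go (b ∷ q) zero =
      trans (coeff-mulP (a * b) (scale a q) r zero)
        (trans (cong (_+ 0#) (*-assoc a b (coeff r zero)))
          (trans (cong (a * (b * coeff r zero) +_) (sym (zeroʳ a)))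
            (trans (sym (distribˡ a _ _)) (cong (a *_) (sym (coeff-mulP b q r zero))))))
    go (b ∷ q) (suc k) =
      trans (coeff-mulP (a * b) (scale a q) r (suc k))
        (trans (cong₂ _+_ (*-assoc a b _) (go q k))
          (trans (sym (distribˡ a _ _)) (cong (a *_) (sym (coeff-mulP b q r (suc k))))))

  mulP-assoc : ∀ p q r → mulP F (mulP F p q) r ≈ mulP F p (mulP F q r)
  mulP-assoc [] q r = ≈-refl
  mulP-assoc (a ∷ p) q r =
    ≈-trans (mulP-distribʳ (scale a q) (0# ∷ mulP F p q) r)
      (addP-cong (mulP-scaleˡ a q r) (≈-trans (shifted (mulP F p q)) (0∷-cong (mulP-assoc p q r))))
    where
    shifted : ∀ x → mulP F (0# ∷ x) r ≈ (0# ∷ mulP F x r)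
    shifted x = mk≈ (λ k → trans (coeff-mulP 0# x r k) (trans (cong (_+ coeff (0# ∷ mulP F x r) k) (zeroˡ _)) (+-identityˡ _)))

  mulP-identityˡ : ∀ q → mulP F (1# ∷ []) q ≈ q
  mulP-identityˡ q = mk≈ (λ k → trans (coeff-mulP 1# [] q k) (trans (cong₂ _+_ (*-identityˡ _) (zero-tail k)) (+-identityʳ _)))
    where
    zero-tail : ∀ k → coeff (0# ∷ []) k ≡ 0#
    zero-tail zero = refl
    zero-tail (suc k) = refl

  length-addP : ∀ p q → length (addP F p q) ≡ length p ℕ.⊔ length q
  length-addP [] q = refl
  length-addP (a ∷ p) [] = refl
  length-addP (a ∷ p) (b ∷ q) = cong suc (length-addP p q)

  length-mulP : ∀ a p b q → length (mulP F (a ∷ p) (b ∷ q)) ≡ suc (length p ℕ.+ length q)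
  length-mulP a [] b q =
    trans (length-addP (scale a (b ∷ q)) (0# ∷ []))
      (trans (cong (ℕ._⊔ 1) (length-map (a *_) (b ∷ q))) (cong suc (ℕP.⊔-identityʳ (length q))))
  length-mulP a (a′ ∷ p) b q =
    trans (length-addP (scale a (b ∷ q)) (0# ∷ mulP F (a′ ∷ p) (b ∷ q)))
      (trans (cong₂ ℕ._⊔_ (length-map (a *_) (b ∷ q)) (cong suc (length-mulP a′ p b q)))
        (cong suc (ℕP.m≤n⇒m⊔n≡n (ℕP.≤-trans (ℕP.m≤n+m (length q) (length p)) (ℕP.n≤1+n _)))))

  ≈∧length⇒≡ : ∀ {p q} → length p ≡ length q → p ≈ q → p ≡ q
  ≈∧length⇒≡ {[]} {[]} _ _ = refl
  ≈∧length⇒≡ {a ∷ p} {b ∷ q} |p|≡|q| p≈q = cong₂ _∷_ (at p≈q zero) (≈∧length⇒≡ (ℕP.suc-injective |p|≡|q|) (≈-tail p≈q))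

  DegreeBelow : Poly F → ℕ → Set
  DegreeBelow x n = ∀ k → n ≤ k → coeff x k ≡ 0#

  mulP-leading : ∀ x y a b → DegreeBelow x (suc a) → DegreeBelow y (suc b) →
    coeff (mulP F x y) (a ℕ.+ b) ≡ coeff x a * coeff y b × DegreeBelow (mulP F x y) (suc (a ℕ.+ b))
  mulP-leading [] y a b _ _ = sym (zeroˡ _) , λ _ _ → refl
  mulP-leading (c ∷ x) y zero b x<1 y<b = leading , below
    where
    x≈0 : x ≈ []
    x≈0 = mk≈ (λ k → x<1 (suc k) (s≤s z≤n))
    tail≈0 : (0# ∷ mulP F x y) ≈ []
    tail≈0 = mk≈ (λ { zero → refl ; (suc k) → at (mulP-zeroˡ x y x≈0) k })
    leading = trans (coeff-mulP c x y b) (trans (cong (c * coeff y b +_) (at tail≈0 b)) (+-identityʳ _))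
    below : DegreeBelow (mulP F (c ∷ x) y) (suc b)
    below k b<k = trans (coeff-mulP c x y k)
      (trans (cong₂ _+_ (trans (cong (c *_) (y<b k b<k)) (zeroʳ c)) (at tail≈0 k)) (+-identityʳ _))
  mulP-leading (c ∷ x) y (suc a) b x<a y<b = leading , below
    where
    ih = mulP-leading x y a b (λ k a<k → x<a (suc k) (s≤s a<k)) y<b
    leading = trans (coeff-mulP c x y (suc (a ℕ.+ b)))
      (trans (cong₂ _+_ (trans (cong (c *_) (y<b (suc (a ℕ.+ b)) (s≤s (ℕP.m≤n+m b a)))) (zeroʳ c)) (proj₁ ih)) (+-identityˡ _))
    below : DegreeBelow (mulP F (c ∷ x) y) (suc (suc (a ℕ.+ b)))
    below (suc k) (s≤s a+b<k) = trans (coeff-mulP c x y (suc k))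
      (trans (cong₂ _+_ (trans (cong (c *_) (y<b (suc k) (ℕP.≤-trans (s≤s (ℕP.m≤n+m b a)) (ℕP.≤-trans (ℕP.n≤1+n _) (s≤s a+b<k))))) (zeroʳ c))
                        (proj₂ ih k a+b<k))
             (+-identityˡ _))

  length-toPoly : ∀ {d} (m : Monic F d) → length (toPoly F m) ≡ suc d
  length-toPoly [] = refl
  length-toPoly (x ∷ m) = cong suc (length-toPoly m)

  coeff-toPoly-leading : ∀ {d} (m : Monic F d) → coeff (toPoly F m) d ≡ 1#
  coeff-toPoly-leading [] = refl
  coeff-toPoly-leading (x ∷ m) = coeff-toPoly-leading m

  toPoly-degreeBelow : ∀ {d} (m : Monic F d) → DegreeBelow (toPoly F m) (suc d)
  toPoly-degreeBelow [] (suc k) _ = refl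
  toPoly-degreeBelow (x ∷ m) (suc k) (s≤s d<k) = toPoly-degreeBelow m k d<k

  toPoly-injective : ∀ {d} (m m′ : Monic F d) → toPoly F m ≡ toPoly F m′ → m ≡ m′
  toPoly-injective [] [] _ = refl
  toPoly-injective (x ∷ m) (y ∷ m′) x∷m≡y∷m′ =
    cong₂ _∷_ (cong (λ l → coeff l 0) x∷m≡y∷m′) (toPoly-injective m m′ (cong (λ { [] → [] ; (_ ∷ l) → l }) x∷m≡y∷m′))

  length-mulP-toPoly : ∀ {d e} (g : Monic F d) (h : Monic F e) → length (mulP F (toPoly F g) (toPoly F h)) ≡ suc (d ℕ.+ e)
  length-mulP-toPoly g h with toPoly F g in g≡ | toPoly F h in h≡
  ... | a ∷ p | b ∷ q = trans (length-mulP a p b q)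
    (cong suc (cong₂ ℕ._+_ (ℕP.suc-injective (trans (cong length (sym g≡)) (length-toPoly g)))
                           (ℕP.suc-injective (trans (cong length (sym h≡)) (length-toPoly h)))))
  ... | [] | _ = ⊥-elim (ℕP.0≢1+n (trans (cong length (sym g≡)) (length-toPoly g)))
  ... | _ ∷ _ | [] = ⊥-elim (ℕP.0≢1+n (trans (cong length (sym h≡)) (length-toPoly h)))

  coeff-mulP-toPoly-leading : ∀ {d e} (g : Monic F d) (h : Monic F e) → coeff (mulP F (toPoly F g) (toPoly F h)) (d ℕ.+ e) ≡ 1#
  coeff-mulP-toPoly-leading {d} {e} g h =
    trans (proj₁ (mulP-leading (toPoly F g) (toPoly F h) d e (toPoly-degreeBelow g) (toPoly-degreeBelow h)))
          (trans (cong₂ _*_ (coeff-toPoly-leading g) (coeff-toPoly-leading h)) (*-identityˡ 1#))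

  toMonic : ∀ n (p : Poly F) → length p ≡ suc n → coeff p n ≡ 1# → Σ (Monic F n) (λ m → toPoly F m ≡ p)
  toMonic zero (x ∷ []) _ x≡1 = [] , cong (_∷ []) (sym x≡1)
  toMonic (suc n) (x ∷ p) |p|≡ p-leading with toMonic n p (ℕP.suc-injective |p|≡) p-leading
  ... | m , m≡p = (x ∷ m) , cong (x ∷_) m≡p

  MonicPoly : Set
  MonicPoly = Σ ℕ (Monic F)

  deg : MonicPoly → ℕ
  deg = proj₁

  poly : MonicPoly → Poly F
  poly (_ , m) = toPoly F m

  one : MonicPoly
  one = 0 , []

  infixl 7 _⊗_
  _⊗_ : MonicPoly → MonicPoly → MonicPoly
  (d , g) ⊗ (e , h) =
    d ℕ.+ e , proj₁ (toMonic (d ℕ.+ e) (mulP F (toPoly F g) (toPoly F h)) (length-mulP-toPoly g h) (coeff-mulP-toPoly-leading g h))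

  poly-⊗ : ∀ x y → poly (x ⊗ y) ≡ mulP F (poly x) (poly y)
  poly-⊗ (d , g) (e , h) =
    proj₂ (toMonic (d ℕ.+ e) (mulP F (toPoly F g) (toPoly F h)) (length-mulP-toPoly g h) (coeff-mulP-toPoly-leading g h))

  poly-⊗-≈ : ∀ x y → poly (x ⊗ y) ≈ mulP F (poly x) (poly y)
  poly-⊗-≈ x y = ≡⇒≈ (poly-⊗ x y)

  -- A monic polynomial is determined by its coefficient function: the leading 1 fixes the degree.
  poly-injective : ∀ x y → poly x ≈ poly y → x ≡ y
  poly-injective (d , g) (e , h) g≈h with same-degree
    where
    same-degree : d ≡ e
    same-degree with ℕP.<-cmp d e
    ... | tri≈ _ d≡e _ = d≡e
    ... | tri< d<e _ _ = ⊥-elim (0≢1 (trans (sym (toPoly-degreeBelow g e d<e)) (trans (at g≈h e) (coeff-toPoly-leading h))))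
    ... | tri> _ _ e<d = ⊥-elim (0≢1 (trans (sym (toPoly-degreeBelow h d e<d)) (trans (sym (at g≈h d)) (coeff-toPoly-leading g))))
  ... | refl = cong (d ,_) (toPoly-injective g h (≈∧length⇒≡ (trans (length-toPoly g) (sym (length-toPoly h))) g≈h))

  ⊗-comm : ∀ x y → x ⊗ y ≡ y ⊗ x
  ⊗-comm x y = poly-injective (x ⊗ y) (y ⊗ x)
    (≈-trans (poly-⊗-≈ x y) (≈-trans (mulP-comm (poly x) (poly y)) (≈-sym (poly-⊗-≈ y x))))

  ⊗-assoc : ∀ x y z → (x ⊗ y) ⊗ z ≡ x ⊗ (y ⊗ z)
  ⊗-assoc x y z = poly-injective ((x ⊗ y) ⊗ z) (x ⊗ (y ⊗ z))
    (≈-trans (poly-⊗-≈ (x ⊗ y) z) (≈-trans (mulP-congˡ (poly z) (poly-⊗-≈ x y))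
      (≈-trans (mulP-assoc (poly x) (poly y) (poly z))
        (≈-sym (≈-trans (poly-⊗-≈ x (y ⊗ z)) (mulP-congʳ (poly x) (poly-⊗-≈ y z)))))))

  ⊗-identityˡ : ∀ x → one ⊗ x ≡ x
  ⊗-identityˡ x = poly-injective (one ⊗ x) x (≈-trans (poly-⊗-≈ one x) (mulP-identityˡ (poly x)))

  ⊗-identityʳ : ∀ x → x ⊗ one ≡ x
  ⊗-identityʳ x = trans (⊗-comm x one) (⊗-identityˡ x)

  zero-or-leading : ∀ p → p ≈ [] ⊎ Σ ℕ (λ a → ¬ coeff p a ≡ 0# × DegreeBelow p (suc a))
  zero-or-leading [] = inj₁ ≈-refl
  zero-or-leading (c ∷ p) with zero-or-leading p
  ... | inj₂ (a , p[a]≢0 , p<a) = inj₂ (suc a , p[a]≢0 , λ { (suc k) (s≤s a<k) → p<a k a<k })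
  ... | inj₁ p≈0 with c ≟ 0#
  ...   | yes c≡0 = inj₁ (mk≈ (λ { zero → c≡0 ; (suc k) → at p≈0 k }))
  ...   | no c≢0 = inj₂ (0 , c≢0 , λ { (suc k) _ → at p≈0 k })

  mulP-monic-zero : ∀ p x → mulP F p (poly x) ≈ [] → p ≈ []
  mulP-monic-zero p (d , g) p*g≈0 with zero-or-leading p
  ... | inj₁ p≈0 = p≈0
  ... | inj₂ (a , p[a]≢0 , p<a) = ⊥-elim (p[a]≢0 (begin
    coeff p a                                  ≡⟨ *-identityʳ _ ⟨
    coeff p a * 1#                             ≡⟨ cong (coeff p a *_) (coeff-toPoly-leading g) ⟨
    coeff p a * coeff (toPoly F g) d           ≡⟨ proj₁ (mulP-leading p (toPoly F g) a d p<a (toPoly-degreeBelow g)) ⟨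
    coeff (mulP F p (toPoly F g)) (a ℕ.+ d)    ≡⟨ at p*g≈0 (a ℕ.+ d) ⟩
    0#                                         ∎))
    where open ≡-Reasoning

  subP : Poly F → Poly F → Poly F
  subP y z = addP F y (scale (- 1#) z)

  -1*x+x≡0 : ∀ x → - 1# * x + x ≡ 0#
  -1*x+x≡0 x = trans (cong (- 1# * x +_) (sym (*-identityˡ x))) (trans (sym (distribʳ x (- 1#) 1#)) (trans (cong (_* x) (-‿inverseˡ 1#)) (zeroˡ x)))

  coeff-subP : ∀ y z k → coeff (subP y z) k ≡ coeff y k + - 1# * coeff z k
  coeff-subP y z k = trans (coeff-addP y (scale (- 1#) z) k) (cong (coeff y k +_) (coeff-scale (- 1#) z k))

  subP-zero⇒≈ : ∀ y z → subP y z ≈ [] → y ≈ z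
  subP-zero⇒≈ y z y-z≈0 = mk≈ (λ k → cancel (coeff y k) (coeff z k) (trans (sym (coeff-subP y z k)) (at y-z≈0 k)))
    where
    cancel : ∀ a b → a + - 1# * b ≡ 0# → a ≡ b
    cancel a b a-b≡0 = begin
      a                         ≡⟨ +-identityʳ a ⟨
      a + 0#                    ≡⟨ cong (a +_) (-1*x+x≡0 b) ⟨
      a + (- 1# * b + b)        ≡⟨ +-assoc a _ b ⟨
      (a + - 1# * b) + b        ≡⟨ cong (_+ b) a-b≡0 ⟩
      0# + b                    ≡⟨ +-identityˡ b ⟩
      b                         ∎
      where open ≡-Reasoning

  ≈⇒subP-zero : ∀ y z → y ≈ z → subP y z ≈ []
  ≈⇒subP-zero y z y≈z = mk≈ (λ k →
    trans (coeff-subP y z k) (trans (cong (_+ - 1# * coeff z k) (at y≈z k)) (trans (+-comm _ _) (-1*x+x≡0 (coeff z k)))))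

  mulP-distribˡ : ∀ x y r → mulP F r (addP F x y) ≈ addP F (mulP F r x) (mulP F r y)
  mulP-distribˡ x y r =
    ≈-trans (mulP-comm r (addP F x y)) (≈-trans (mulP-distribʳ x y r) (addP-cong (mulP-comm x r) (mulP-comm y r)))

  scale-cong : ∀ a {p q} → p ≈ q → scale a p ≈ scale a q
  scale-cong a {p} {q} p≈q = mk≈ (λ k → trans (coeff-scale a p k) (trans (cong (a *_) (at p≈q k)) (sym (coeff-scale a q k))))

  mulP-scaleʳ : ∀ a q r → mulP F r (scale a q) ≈ scale a (mulP F r q)
  mulP-scaleʳ a q r =
    ≈-trans (mulP-comm r (scale a q)) (≈-trans (mulP-scaleˡ a q r) (scale-cong a (mulP-comm q r)))

  mulP-subPʳ : ∀ r y z → mulP F r (subP y z) ≈ subP (mulP F r y) (mulP F r z)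
  mulP-subPʳ r y z = ≈-trans (mulP-distribˡ y (scale (- 1#) z) r) (addP-cong ≈-refl (mulP-scaleʳ (- 1#) z r))

  mulP-subPˡ : ∀ y z h → mulP F (subP y z) h ≈ subP (mulP F y h) (mulP F z h)
  mulP-subPˡ y z h =
    ≈-trans (mulP-comm (subP y z) h)
      (≈-trans (mulP-subPʳ h y z) (addP-cong (mulP-comm h y) (scale-cong (- 1#) (mulP-comm h z))))

  -- Monic polynomials are not zero divisors.
  ⊗-cancelˡ : ∀ x y z → x ⊗ y ≡ x ⊗ z → y ≡ z
  ⊗-cancelˡ x y z xy≡xz = poly-injective y z (subP-zero⇒≈ (poly y) (poly z) (mulP-monic-zero (subP (poly y) (poly z)) x
    (≈-trans (mulP-comm _ (poly x)) (≈-trans (mulP-subPʳ (poly x) (poly y) (poly z))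
      (≈⇒subP-zero _ _ (≈-trans (≈-sym (poly-⊗-≈ x y)) (≈-trans (≡⇒≈ (cong poly xy≡xz)) (poly-⊗-≈ x z))))))))

  monicOf : ∀ x n → coeff x n ≡ 1# → DegreeBelow x (suc n) → Σ (Monic F n) λ m → toPoly F m ≈ x
  monicOf x n x[n]≡1 x<n = fromCoeffs (coeff x) n , mk≈ agree
    where
    fromCoeffs : (ℕ → Carrier) → ∀ n → Monic F n
    fromCoeffs f zero = []
    fromCoeffs f (suc n) = f 0 ∷ fromCoeffs (λ k → f (suc k)) n
    below : ∀ f n k → k < n → coeff (toPoly F (fromCoeffs f n)) k ≡ f k
    below f (suc n) zero _ = refl
    below f (suc n) (suc k) (s≤s k<n) = below (λ k → f (suc k)) n k k<n
    agree : ∀ k → coeff (toPoly F (fromCoeffs (coeff x) n)) k ≡ coeff x k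
    agree k with ℕP.<-cmp k n
    ... | tri< k<n _ _ = below (coeff x) n k k<n
    ... | tri≈ _ refl _ = trans (coeff-toPoly-leading (fromCoeffs (coeff x) n)) (sym x[n]≡1)
    ... | tri> _ _ n<k = trans (toPoly-degreeBelow (fromCoeffs (coeff x) n) k n<k) (sym (x<n k n<k))

  addP-zeroʳ : ∀ x r → r ≈ [] → addP F x r ≈ x
  addP-zeroʳ x r r≈0 = mk≈ (λ k → trans (coeff-addP x r k) (trans (cong (coeff x k +_) (at r≈0 k)) (+-identityʳ _)))

  divMod : ∀ (m : MonicPoly) x → Σ (Poly F) λ q → Σ (Poly F) λ r → x ≈ addP F (mulP F q (poly m)) r × DegreeBelow r (deg m)
  divMod m [] = [] , [] , ≈-refl , λ _ _ → refl
  divMod m@(d , g) (a ∷ x) with divMod m x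
  ... | q , r , x≈qm+r , r<d = c ∷ q , r′ , a∷x≈ , r′<d
    where
    M = poly m
    s = a ∷ r
    c = coeff s d
    r′ = subP s (scale c M)
    coeff-r′ : ∀ k → coeff r′ k ≡ coeff s k + - 1# * (c * coeff M k)
    coeff-r′ k = trans (coeff-subP s (scale c M) k) (cong (λ z → coeff s k + - 1# * z) (coeff-scale c M k))
    rearrange : ∀ u T S → (u + T) + (S + - 1# * u) ≡ T + S
    rearrange u T S =
      trans (solve 4 (λ u T S n → (u :+ T) :+ (S :+ n :* u) := (T :+ S) :+ (n :* u :+ u)) refl u T S (- 1#))
            (trans (cong ((T + S) +_) (-1*x+x≡0 u)) (+-identityʳ _))
    shifted : ∀ k → coeff (0# ∷ mulP F q M) k + coeff s k ≡ coeff (a ∷ x) k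
    shifted zero = +-identityˡ a
    shifted (suc k) = trans (sym (coeff-addP (mulP F q M) r k)) (sym (at x≈qm+r k))
    a∷x≈ : (a ∷ x) ≈ addP F (mulP F (c ∷ q) M) r′
    a∷x≈ = mk≈ λ k → sym (trans (coeff-addP (mulP F (c ∷ q) M) r′ k)
      (trans (cong₂ _+_ (coeff-mulP c q M k) (coeff-r′ k)) (trans (rearrange (c * coeff M k) _ _) (shifted k))))
    r′<d : DegreeBelow r′ d
    r′<d k d≤k with ℕP.m≤n⇒m<n∨m≡n d≤k
    ... | inj₂ refl = trans (coeff-r′ d)
      (trans (cong (λ z → c + - 1# * z) (trans (cong (c *_) (coeff-toPoly-leading g)) (*-identityʳ c)))
        (trans (+-comm _ _) (-1*x+x≡0 c)))
    ... | inj₁ d<k = trans (coeff-r′ k)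
      (trans (cong₂ (λ z w → z + - 1# * w) (s-vanishes k d<k) (trans (cong (c *_) (toPoly-degreeBelow g k d<k)) (zeroʳ c)))
        (trans (+-identityˡ _) (zeroʳ (- 1#))))
      where
      s-vanishes : ∀ k → d < k → coeff s k ≡ 0#
      s-vanishes (suc k) (s≤s d≤k) = r<d k d≤k

  remainder-≈ : ∀ X q M r → X ≈ addP F (mulP F q M) r → r ≈ subP X (mulP F q M)
  remainder-≈ X q M r X≈qM+r = mk≈ (λ k →
    trans (solved (coeff (mulP F q M) k) (coeff r k))
      (trans (cong (_+ - 1# * coeff (mulP F q M) k) (trans (sym (coeff-addP (mulP F q M) r k)) (sym (at X≈qM+r k))))
        (sym (coeff-subP X (mulP F q M) k))))
    where
    solved : ∀ u r → r ≡ (u + r) + - 1# * u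
    solved u r = sym (trans (solve 3 (λ u r n → (u :+ r) :+ n :* u := r :+ (n :* u :+ u)) refl u r (- 1#))
                            (trans (cong (r +_) (-1*x+x≡0 u)) (+-identityʳ r)))

  infix 4 _∣_ _∣ₚ_
  _∣_ : MonicPoly → MonicPoly → Set
  x ∣ y = Σ MonicPoly λ z → x ⊗ z ≡ y

  _∣ₚ_ : MonicPoly → Poly F → Set
  P ∣ₚ x = Σ (Poly F) λ q → x ≈ mulP F (poly P) q

  ∣ₚ-resp-≈ : ∀ {P x y} → x ≈ y → P ∣ₚ x → P ∣ₚ y
  ∣ₚ-resp-≈ x≈y (q , x≈Pq) = q , ≈-trans (≈-sym x≈y) x≈Pq

  ∣ₚ-mulPˡ : ∀ {P} x y → P ∣ₚ x → P ∣ₚ mulP F y x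
  ∣ₚ-mulPˡ {P} x y (q , x≈Pq) = mulP F y q ,
    ≈-trans (mulP-congʳ y x≈Pq) (≈-trans (≈-sym (mulP-assoc y (poly P) q))
      (≈-trans (mulP-congˡ q (mulP-comm y (poly P))) (mulP-assoc (poly P) y q)))

  ∣ₚ-mulPʳ : ∀ {P} x y → P ∣ₚ x → P ∣ₚ mulP F x y
  ∣ₚ-mulPʳ {P} x y P∣x = ∣ₚ-resp-≈ {P} (mulP-comm y x) (∣ₚ-mulPˡ {P} x y P∣x)

  ∣ₚ-subP : ∀ {P} x y → P ∣ₚ x → P ∣ₚ y → P ∣ₚ subP x y
  ∣ₚ-subP {P} x y (q₁ , x≈Pq₁) (q₂ , y≈Pq₂) = subP q₁ q₂ ,
    ≈-trans (addP-cong x≈Pq₁ (scale-cong (- 1#) y≈Pq₂)) (≈-sym (mulP-subPʳ (poly P) q₁ q₂))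

  ∣ₚ-scale : ∀ {P} a x → P ∣ₚ x → P ∣ₚ scale a x
  ∣ₚ-scale {P} a x (q , x≈Pq) = scale a q , ≈-trans (scale-cong a x≈Pq) (≈-sym (mulP-scaleʳ a q (poly P)))

  ∣⇒∣ₚ : ∀ {P x} → P ∣ x → P ∣ₚ poly x
  ∣⇒∣ₚ {P} (z , refl) = poly z , poly-⊗-≈ P z

  monic-cofactor : ∀ (X M : MonicPoly) q → poly X ≈ mulP F q (poly M) → Σ MonicPoly λ Q → Q ⊗ M ≡ X
  monic-cofactor (e , P) (d , m) q P≈qm with zero-or-leading q
  ... | inj₁ q≈0 = ⊥-elim (0≢1 (sym (trans (sym (coeff-toPoly-leading P)) (trans (at P≈qm e) (at (mulP-zeroˡ q (toPoly F m) q≈0) e)))))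
  ... | inj₂ (a , q[a]≢0 , q<a) = Q , poly-injective (Q ⊗ (d , m)) (e , P)
          (≈-trans (poly-⊗-≈ Q (d , m)) (≈-trans (mulP-congˡ (toPoly F m) (proj₂ monic-q)) (≈-sym P≈qm)))
    where
    leading = mulP-leading q (toPoly F m) a d q<a (toPoly-degreeBelow m)
    qm[a+d]≡q[a] : coeff (mulP F q (toPoly F m)) (a ℕ.+ d) ≡ coeff q a
    qm[a+d]≡q[a] = trans (proj₁ leading) (trans (cong (coeff q a *_) (coeff-toPoly-leading m)) (*-identityʳ _))
    a+d≡e : a ℕ.+ d ≡ e
    a+d≡e with ℕP.<-cmp (a ℕ.+ d) e
    ... | tri≈ _ a+d≡e _ = a+d≡e
    ... | tri< a+d<e _ _ = ⊥-elim (0≢1 (trans (sym (proj₂ leading e a+d<e)) (trans (sym (at P≈qm e)) (coeff-toPoly-leading P))))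
    ... | tri> _ _ e<a+d = ⊥-elim (q[a]≢0 (trans (sym qm[a+d]≡q[a]) (trans (sym (at P≈qm (a ℕ.+ d))) (toPoly-degreeBelow P (a ℕ.+ d) e<a+d))))
    monic-q : Σ (Monic F a) λ m → toPoly F m ≈ q
    monic-q = monicOf q a (trans (sym qm[a+d]≡q[a]) (trans (sym (at P≈qm (a ℕ.+ d))) (trans (cong (coeff (toPoly F P)) a+d≡e) (coeff-toPoly-leading P)))) q<a
    Q : MonicPoly
    Q = a , proj₁ monic-q

  IsIrreducible : MonicPoly → Set
  IsIrreducible P = 1 ≤ deg P × (∀ y z → y ⊗ z ≡ P → deg y ≡ 0 ⊎ deg z ≡ 0)

  -- Reduce P modulo M: P = q·M + r with deg r < deg M, and P ∣ r·h since P ∣ P·h and P ∣ q·M·h;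
  -- if r = 0 then M ∣ P, so irreducibility forces M = 1.
  irreducible-∣ₚ-monic : ∀ P → IsIrreducible P → ∀ M h → deg M < deg P →
    (∀ r → DegreeBelow r (deg M) → ¬ r ≈ [] → P ∣ₚ mulP F r h → P ∣ₚ h) →
    P ∣ₚ mulP F (poly M) h → P ∣ₚ h
  irreducible-∣ₚ-monic P (_ , irreducible) M h M<P lower P∣Mh with divMod M (poly P)
  ... | q , r , P≈qM+r , r<M with zero-or-leading r
  ...   | inj₂ (a , r[a]≢0 , _) = lower r r<M (λ r≈0 → r[a]≢0 (at r≈0 a)) P∣rh
    where
    P∣rh : P ∣ₚ mulP F r h
    P∣rh = ∣ₚ-resp-≈ {P}
      (≈-sym (≈-trans (mulP-congˡ h (remainder-≈ (poly P) q (poly M) r P≈qM+r)) (mulP-subPˡ (poly P) (mulP F q (poly M)) h)))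
      (∣ₚ-subP {P} (mulP F (poly P) h) (mulP F (mulP F q (poly M)) h) (h , ≈-refl)
        (∣ₚ-resp-≈ {P} (≈-sym (mulP-assoc q (poly M) h)) (∣ₚ-mulPˡ {P} (mulP F (poly M) h) q P∣Mh)))
  ...   | inj₁ r≈0 with monic-cofactor P M q (≈-trans P≈qM+r (addP-zeroʳ (mulP F q (poly M)) r r≈0))
  ...     | Q , Q⊗M≡P with irreducible Q M Q⊗M≡P
  ...       | inj₁ degQ≡0 = ⊥-elim (ℕP.<-irrefl (sym (trans (cong deg (sym Q⊗M≡P)) (cong (ℕ._+ deg M) degQ≡0))) M<P)
  ...       | inj₂ degM≡0 = ∣ₚ-resp-≈ {P} (≈-trans (mulP-congˡ h (unit M degM≡0)) (mulP-identityˡ h)) P∣Mh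
    where
    unit : ∀ M → deg M ≡ 0 → poly M ≈ (1# ∷ [])
    unit (zero , []) _ = ≈-refl

  -- Induction on the degree bound d: once r is scaled to a monic M, irreducible-∣ₚ-monic
  -- passes to a remainder of smaller degree.
  irreducible-∣ₚ-cancel : ∀ P → IsIrreducible P → ∀ d → d ≤ deg P →
    ∀ r h → DegreeBelow r d → ¬ r ≈ [] → P ∣ₚ mulP F r h → P ∣ₚ h
  irreducible-∣ₚ-cancel P irr zero _ r h r<0 r≉0 _ = ⊥-elim (r≉0 (mk≈ (λ k → r<0 k z≤n)))
  irreducible-∣ₚ-cancel P irr (suc d) d<P r h r<1+d r≉0 P∣rh with coeff r d ≟ 0#
  ... | yes r[d]≡0 = irreducible-∣ₚ-cancel P irr d (ℕP.≤-trans (ℕP.n≤1+n d) d<P) r h r<d r≉0 P∣rh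
    where
    r<d : DegreeBelow r d
    r<d k d≤k with ℕP.m≤n⇒m<n∨m≡n d≤k
    ... | inj₂ refl = r[d]≡0
    ... | inj₁ d<k = r<1+d k d<k
  ... | no r[d]≢0 with inverse (coeff r d) r[d]≢0
  ...   | c⁻¹ , c*c⁻¹≡1 =
    irreducible-∣ₚ-monic P irr M h d<P (λ r′ → irreducible-∣ₚ-cancel P irr d (ℕP.≤-trans (ℕP.n≤1+n d) d<P) r′ h) P∣Mh
    where
    normalised : Σ (Monic F d) λ m → toPoly F m ≈ scale c⁻¹ r
    normalised = monicOf (scale c⁻¹ r) d (trans (coeff-scale c⁻¹ r d) (trans (*-comm c⁻¹ _) c*c⁻¹≡1))
      (λ k d<k → trans (coeff-scale c⁻¹ r k) (trans (cong (c⁻¹ *_) (r<1+d k d<k)) (zeroʳ c⁻¹)))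
    M : MonicPoly
    M = d , proj₁ normalised
    P∣Mh : P ∣ₚ mulP F (poly M) h
    P∣Mh = ∣ₚ-resp-≈ {P} (≈-sym (≈-trans (mulP-congˡ h (proj₂ normalised)) (mulP-scaleˡ c⁻¹ r h)))
             (∣ₚ-scale {P} c⁻¹ (mulP F r h) P∣rh)

  irreducible-∣-⊗ : ∀ P → IsIrreducible P → ∀ x y → P ∣ x ⊗ y → P ∣ x ⊎ P ∣ y
  irreducible-∣-⊗ P irr x y P∣xy with divMod P (poly x)
  ... | q , r , x≈qP+r , r<P with zero-or-leading r
  ...   | inj₁ r≈0 = inj₁ (Q , trans (⊗-comm P Q) Q⊗P≡x)
    where
    cofactor = monic-cofactor x P q (≈-trans x≈qP+r (addP-zeroʳ (mulP F q (poly P)) r r≈0))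
    Q = proj₁ cofactor
    Q⊗P≡x = proj₂ cofactor
  ...   | inj₂ (a , r[a]≢0 , _) = inj₂ (Q , trans (⊗-comm P Q) Q⊗P≡y)
    where
    P∣ry : P ∣ₚ mulP F r (poly y)
    P∣ry = ∣ₚ-resp-≈ {P}
      (≈-sym (≈-trans (mulP-congˡ (poly y) (remainder-≈ (poly x) q (poly P) r x≈qP+r)) (mulP-subPˡ (poly x) (mulP F q (poly P)) (poly y))))
      (∣ₚ-subP {P} (mulP F (poly x) (poly y)) (mulP F (mulP F q (poly P)) (poly y))
        (∣ₚ-resp-≈ {P} (poly-⊗-≈ x y) (∣⇒∣ₚ {P} P∣xy))
        (∣ₚ-mulPʳ {P} (mulP F q (poly P)) (poly y) (q , mulP-comm q (poly P))))
    P∣y = irreducible-∣ₚ-cancel P irr (deg P) ℕP.≤-refl r (poly y) r<P (λ r≈0 → r[a]≢0 (at r≈0 a)) P∣ry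
    cofactor = monic-cofactor y P (proj₁ P∣y) (≈-trans (proj₂ P∣y) (mulP-comm (poly P) (proj₁ P∣y)))
    Q = proj₁ cofactor
    Q⊗P≡y = proj₂ cofactor

module Factorisation (F : FiniteField) where

  open import Data.Bool using (Bool; true; false; T; _∧_; not)
  open import Data.Bool.ListAction using (any)
  open import Data.Empty using (⊥-elim)
  open import Data.List using (List; []; _∷_; map; length; _++_; concatMap)
  open import Data.List.Membership.Propositional using (_∈_)
  open import Data.List.Membership.Propositional.Properties using (∈-map⁺; ∈-map⁻; ∈-upTo⁺; ∈-upTo⁻; ∈-++⁺ˡ; ∈-++⁺ʳ; ∈-++⁻)
  open import Data.List.Relation.Unary.Any using (here; there)
  open import Data.List.Relation.Unary.All as All using (All; []; _∷_)
  import Data.List.Relation.Unary.All.Properties as All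
  open import Data.List.Relation.Unary.AllPairs using ([]; _∷_)
  open import Data.List.Relation.Unary.Unique.Propositional using (Unique)
  import Data.List.Relation.Unary.Unique.Propositional.Properties as Unique
  open import Data.Nat as ℕ using (ℕ; zero; suc; _≤_; _<_; _∸_; z≤n; s≤s; _≤ᵇ_)
  import Data.Nat.Properties as ℕP
  open import Data.Product using (Σ; _×_; _,_; proj₁; proj₂)
  open import Data.Sum using (_⊎_; inj₁; inj₂)
  open import Data.Vec using (Vec; []; _∷_)
  open import Data.List.Properties using (≡-dec; map-++; map-∘; length-map)
  open import Data.List.Relation.Binary.Permutation.Propositional using (_↭_)
  open import Data.List.Relation.Binary.Permutation.Propositional.Properties using (↭-length)
  import Data.Integer as ℤ
  open import Function using (_∘_)
  open import Relation.Binary.PropositionalEquality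
  open import Relation.Nullary using (¬_; yes; no)
  open Lists
  open MonicPolynomials F

  open FiniteField F using (Carrier; elements; complete; unique; _≟_)

  allMonic-complete : ∀ d (m : Monic F d) → m ∈ allMonic F d
  allMonic-complete zero [] = here refl
  allMonic-complete (suc d) (c ∷ m) =
    ∈-concatMap⁺′ (λ c → map (c ∷_) (allMonic F d)) (complete c) (∈-map⁺ (c ∷_) (allMonic-complete d m))

  allMonic-unique : ∀ d → Unique (allMonic F d)
  allMonic-unique zero = All.[] ∷ []
  allMonic-unique (suc d) = Unique-concatMap⁺ (λ c → map (c ∷_) (allMonic F d)) head unique
    (λ c → Unique.map⁺ (λ { refl → refl }) (allMonic-unique d)) head-key
    where
    head : Vec Carrier (suc d) → Carrier
    head (c ∷ _) = c
    head-key : ∀ c {m} → m ∈ map (c ∷_) (allMonic F d) → head m ≡ c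
    head-key c m∈ with ∈-map⁻ (c ∷_) m∈
    ... | _ , _ , refl = refl

  eqP-true : ∀ {p q} → p ≡ q → eqP F p q ≡ true
  eqP-true {p} {q} p≡q with ≡-dec _≟_ p q
  ... | yes _ = refl
  ... | no p≢q = ⊥-elim (p≢q p≡q)

  eqP-true⁻ : ∀ {p q} → eqP F p q ≡ true → p ≡ q
  eqP-true⁻ {p} {q} _ with ≡-dec _≟_ p q
  ... | yes p≡q = p≡q

  ∣⇒DividesP : ∀ x y → x ∣ y → DividesP F (poly x) (poly y)
  ∣⇒DividesP x y (z , x⊗z≡y) = proj₁ z , proj₂ z , trans (sym (poly-⊗ x z)) (cong poly x⊗z≡y)

  DividesP⇒∣ : ∀ x y → DividesP F (poly x) (poly y) → x ∣ y
  DividesP⇒∣ x y (k , h , xh≡y) = (k , h) , poly-injective (x ⊗ (k , h)) y (≡⇒≈ (trans (poly-⊗ x (k , h)) xh≡y))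

  ∣⇒deg≤ : ∀ x y → x ∣ y → deg x ≤ deg y
  ∣⇒deg≤ x y (z , x⊗z≡y) = subst (deg x ≤_) (cong deg x⊗z≡y) (ℕP.m≤m+n (deg x) (deg z))

  ∣⇒dividesB : ∀ x {n} (f : Monic F n) → x ∣ (n , f) → dividesB F (poly x) f ≡ true
  ∣⇒dividesB x {n} f (z , x⊗z≡f) =
    any-true⁺ _ (∈-upTo⁺ (s≤s (∣⇒deg≤ z (n , f) (x , trans (⊗-comm z x) x⊗z≡f))))
      (any-true⁺ _ (allMonic-complete (deg z) (proj₂ z)) (eqP-true (trans (sym (poly-⊗ x z)) (cong poly x⊗z≡f))))

  dividesB⇒DividesP : ∀ g {n} (f : Monic F n) → dividesB F g f ≡ true → DividesP F g (toPoly F f)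
  dividesB⇒DividesP g {n} f divides with any-true⁻ _ (range0 F n) divides
  ... | k , _ , some-h with any-true⁻ _ (allMonic F k) some-h
  ...   | h , _ , gh≡f = k , h , eqP-true⁻ gh≡f

  dividesB⇒∣ : ∀ x {n} (f : Monic F n) → dividesB F (poly x) f ≡ true → x ∣ (n , f)
  dividesB⇒∣ x f divides = DividesP⇒∣ x (_ , f) (dividesB⇒DividesP (poly x) f divides)

  Irreducible⇒IsIrreducible : ∀ {e} (p : Monic F e) → Irreducible F p → IsIrreducible (e , p)
  Irreducible⇒IsIrreducible p (1≤e , irreducible) =
    1≤e , λ y z y⊗z≡p → irreducible (deg y) (deg z) (proj₂ y) (proj₂ z) (trans (sym (poly-⊗ y z)) (cong poly y⊗z≡p))

  IsIrreducible⇒Irreducible : ∀ {e} (p : Monic F e) → IsIrreducible (e , p) → Irreducible F p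
  IsIrreducible⇒Irreducible p (1≤e , irreducible) =
    1≤e , λ k l a b ab≡p → irreducible (k , a) (l , b) (poly-injective _ _ (≡⇒≈ (trans (poly-⊗ (k , a) (l , b)) ab≡p)))

  toPoly-subst : ∀ {l l′} (l≡l′ : l ≡ l′) (b : Monic F l) → toPoly F (subst (Monic F) l≡l′ b) ≡ toPoly F b
  toPoly-subst refl b = refl

  -- The inner search of irrB: irrB p reduces to (1 ≤ᵇ e) ∧ not (hasProperFactorB p).
  hasProperFactorB : ∀ {e} → Monic F e → Bool
  hasProperFactorB {e} p =
    any (λ k → any (λ a → any (λ b → eqP F (mulP F (toPoly F a) (toPoly F b)) (toPoly F p))
                                 (allMonic F (e ∸ k)))
                   (allMonic F k))
        (range1 F (e ∸ 1))

  hasProperFactorB⁻ : ∀ {e} (p : Monic F e) → hasProperFactorB p ≡ true →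
    Σ MonicPoly λ y → Σ MonicPoly λ z → y ⊗ z ≡ (e , p) × 1 ≤ deg y × 1 ≤ deg z
  hasProperFactorB⁻ {e} p found with any-true⁻ _ (range1 F (e ∸ 1)) found
  ... | k , k∈ , found-a with any-true⁻ _ (allMonic F k) found-a
  ...   | a , _ , found-b with any-true⁻ _ (allMonic F (e ∸ k)) found-b
  ...     | b , _ , ab≡p with ∈-map⁻ suc k∈
  ...       | k′ , k′∈ , refl =
    (suc k′ , a) , (e ∸ suc k′ , b) , poly-injective _ _ (≡⇒≈ (trans (poly-⊗ (suc k′ , a) (e ∸ suc k′ , b)) (eqP-true⁻ ab≡p))) ,
    s≤s z≤n , ℕP.m<n⇒0<n∸m (1+k′<e {e} (∈-upTo⁻ k′∈))
    where
    1+k′<e : ∀ {e} → k′ < e ∸ 1 → suc k′ < e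
    1+k′<e {suc e} k′<e = s≤s k′<e

  IsIrreducible⇒irrB : ∀ {e} (p : Monic F e) → IsIrreducible (e , p) → irrB F p ≡ true
  IsIrreducible⇒irrB {e} p (1≤e , irreducible) =
    cong₂ (λ u v → u ∧ not v) (T⇒≡true (ℕP.≤⇒≤ᵇ 1≤e)) (¬T⇒≡false (no-proper-factor ∘ T⇒≡true))
    where
    no-proper-factor : ¬ hasProperFactorB p ≡ true
    no-proper-factor found with hasProperFactorB⁻ p found
    ... | y , z , y⊗z≡p , 1≤y , 1≤z with irreducible y z y⊗z≡p
    ...   | inj₁ y≡0 = ℕP.<⇒≢ 1≤y (sym y≡0)
    ...   | inj₂ z≡0 = ℕP.<⇒≢ 1≤z (sym z≡0)

  irrB⇒IsIrreducible : ∀ {e} (p : Monic F e) → irrB F p ≡ true → IsIrreducible (e , p)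
  irrB⇒IsIrreducible {e} p irr with ∧-true⁻ {1 ≤ᵇ e} {not (hasProperFactorB p)} irr
  ... | 1≤ᵇe , none = ℕP.≤ᵇ⇒≤ 1 e (subst T (sym 1≤ᵇe) _) , irreducible
    where
    irreducible : ∀ y z → y ⊗ z ≡ (e , p) → deg y ≡ 0 ⊎ deg z ≡ 0
    irreducible (zero , a) z _ = inj₁ refl
    irreducible (suc k′ , a) (zero , b) _ = inj₂ refl
    irreducible (suc k′ , a) (suc l′ , b) y⊗z≡p = ⊥-elim (false≢true (trans (sym (not-true⁻ none)) found))
      where
      k+l≡e : suc k′ ℕ.+ suc l′ ≡ e
      k+l≡e = cong deg y⊗z≡p
      e∸k≡l : e ∸ suc k′ ≡ suc l′
      e∸k≡l = trans (cong (_∸ suc k′) (sym k+l≡e)) (ℕP.m+n∸m≡n (suc k′) (suc l′))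
      k′<e∸1 : k′ < e ∸ 1
      k′<e∸1 = subst (λ z → k′ < z ∸ 1) k+l≡e (subst (k′ <_) (sym (ℕP.+-suc k′ l′)) (s≤s (ℕP.m≤m+n k′ l′)))
      found : hasProperFactorB p ≡ true
      found = any-true⁺ _ {range1 F (e ∸ 1)} (∈-map⁺ suc (∈-upTo⁺ k′<e∸1))
        (any-true⁺ _ (allMonic-complete (suc k′) a) (any-true⁺ _ (allMonic-complete (e ∸ suc k′) (subst (Monic F) (sym e∸k≡l) b))
          (eqP-true (trans (cong (mulP F (toPoly F a)) (toPoly-subst (sym e∸k≡l) b))
                           (trans (sym (poly-⊗ (suc k′ , a) (suc l′ , b))) (cong poly y⊗z≡p))))))

  ∣-refl : ∀ x → x ∣ x
  ∣-refl x = one , ⊗-identityʳ x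

  ∣-trans : ∀ {x y z} → x ∣ y → y ∣ z → x ∣ z
  ∣-trans {x} (a , x⊗a≡y) (b , y⊗b≡z) = a ⊗ b , trans (sym (⊗-assoc x a b)) (trans (cong (_⊗ b) x⊗a≡y) y⊗b≡z)

  ∣-⊗ˡ : ∀ x y → x ∣ x ⊗ y
  ∣-⊗ˡ x y = y , refl

  ∣-⊗ʳ : ∀ x y → y ∣ x ⊗ y
  ∣-⊗ʳ x y = x , ⊗-comm y x

  ⊗-monoʳ-∣ : ∀ c {a b} → a ∣ b → c ⊗ a ∣ c ⊗ b
  ⊗-monoʳ-∣ c {a} (z , a⊗z≡b) = z , trans (⊗-assoc c a z) (cong (c ⊗_) a⊗z≡b)

  deg≡0⇒one : ∀ x → deg x ≡ 0 → x ≡ one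
  deg≡0⇒one (zero , []) _ = refl

  squareful⁺ : ∀ P X → IsIrreducible P → P ⊗ P ∣ X → Squareful F (proj₂ X)
  squareful⁺ P X irr P²∣X =
    deg P , proj₂ P , IsIrreducible⇒Irreducible (proj₂ P) irr ,
    subst (λ z → DividesP F z (poly X)) (poly-⊗ P P) (∣⇒DividesP (P ⊗ P) X P²∣X)

  squareful⁻ : ∀ X → Squareful F (proj₂ X) → Σ MonicPoly λ P → IsIrreducible P × P ⊗ P ∣ X
  squareful⁻ X (e , p , irr , p²∣X) =
    (e , p) , Irreducible⇒IsIrreducible p irr ,
    DividesP⇒∣ ((e , p) ⊗ (e , p)) X (subst (λ z → DividesP F z (poly X)) (sym (poly-⊗ (e , p) (e , p))) p²∣X)

  ¬squareful-∣ : ∀ X Y → ¬ Squareful F (proj₂ X) → Y ∣ X → ¬ Squareful F (proj₂ Y)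
  ¬squareful-∣ X Y X-squarefree Y∣X Y-squareful with squareful⁻ Y Y-squareful
  ... | P , irr , P²∣Y = X-squarefree (squareful⁺ P X irr (∣-trans {P ⊗ P} {Y} {X} P²∣Y Y∣X))

  ¬Squareful⇒squarefreeB : ∀ {n} (f : Monic F n) → ¬ Squareful F f → squarefreeB F f ≡ true
  ¬Squareful⇒squarefreeB {n} f f-squarefree with squarefreeB F f in sqf
  ... | true = refl
  ... | false with any-true⁻ _ (range1 F n) (not-false⁻ sqf)
  ...   | d , _ , found with any-true⁻ _ (allMonic F d) found
  ...     | p , _ , p-irr∧p²∣f with ∧-true⁻ {irrB F p} p-irr∧p²∣f
  ...       | p-irr , p²∣f = ⊥-elim (f-squarefree
    (d , p , IsIrreducible⇒Irreducible p (irrB⇒IsIrreducible p p-irr) , dividesB⇒DividesP (mulP F (toPoly F p) (toPoly F p)) f p²∣f))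

  prod : List MonicPoly → MonicPoly
  prod [] = one
  prod (x ∷ xs) = x ⊗ prod xs

  prod-++ : ∀ xs ys → prod (xs ++ ys) ≡ prod xs ⊗ prod ys
  prod-++ [] ys = sym (⊗-identityˡ (prod ys))
  prod-++ (x ∷ xs) ys = trans (cong (x ⊗_) (prod-++ xs ys)) (sym (⊗-assoc x (prod xs) (prod ys)))

  factorise : ∀ bound x → deg x < bound → Σ (List MonicPoly) λ Fs → All IsIrreducible Fs × prod Fs ≡ x
  factorise (suc bound) (zero , []) _ = [] , [] , refl
  factorise (suc bound) (suc e , p) (s≤s e<bound) with irrB F p in irr
  ... | true = ((suc e , p) ∷ []) , (irrB⇒IsIrreducible p irr ∷ []) , ⊗-identityʳ _
  ... | false with hasProperFactorB⁻ p (not-false⁻ irr)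
  ...   | y , z , y⊗z≡p , 1≤y , 1≤z =
    proj₁ fy ++ proj₁ fz , All.++⁺ (proj₁ (proj₂ fy)) (proj₁ (proj₂ fz)) ,
    trans (prod-++ (proj₁ fy) (proj₁ fz)) (trans (cong₂ _⊗_ (proj₂ (proj₂ fy)) (proj₂ (proj₂ fz))) y⊗z≡p)
    where
    degs : deg y ℕ.+ deg z ≡ suc e
    degs = cong deg y⊗z≡p
    fy = factorise bound y (ℕP.≤-trans (subst (deg y <_) degs (subst (_≤ deg y ℕ.+ deg z) (ℕP.+-comm (deg y) 1) (ℕP.+-monoʳ-≤ (deg y) 1≤z))) e<bound)
    fz = factorise bound z (ℕP.≤-trans (subst (deg z <_) degs (ℕP.+-monoˡ-≤ (deg z) 1≤y)) e<bound)

  irreducible-∤-one : ∀ P → IsIrreducible P → ¬ P ∣ one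
  irreducible-∤-one P (1≤P , _) P∣one = ℕP.<⇒≱ 1≤P (∣⇒deg≤ P one P∣one)

  irreducible-∣-irreducible : ∀ P Q → IsIrreducible P → IsIrreducible Q → P ∣ Q → P ≡ Q
  irreducible-∣-irreducible P Q (1≤P , _) (_ , Q-irreducible) (z , P⊗z≡Q) with Q-irreducible P z P⊗z≡Q
  ... | inj₁ P≡0 = ⊥-elim (ℕP.<⇒≢ 1≤P (sym P≡0))
  ... | inj₂ z≡0 = trans (sym (⊗-identityʳ P)) (trans (cong (P ⊗_) (sym (deg≡0⇒one z z≡0))) P⊗z≡Q)

  ∈⇒∣prod : ∀ {P} S → P ∈ S → P ∣ prod S
  ∈⇒∣prod (x ∷ S) (here refl) = ∣-⊗ˡ x (prod S)
  ∈⇒∣prod {P} (x ∷ S) (there P∈S) = ∣-trans {P} {prod S} {x ⊗ prod S} (∈⇒∣prod S P∈S) (∣-⊗ʳ x (prod S))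

  irreducible-∣-prod⇒∈ : ∀ P → IsIrreducible P → ∀ S → All IsIrreducible S → P ∣ prod S → P ∈ S
  irreducible-∣-prod⇒∈ P irr [] _ P∣one = ⊥-elim (irreducible-∤-one P irr P∣one)
  irreducible-∣-prod⇒∈ P irr (x ∷ S) (x-irr ∷ S-irr) P∣x⊗S with irreducible-∣-⊗ P irr x (prod S) P∣x⊗S
  ... | inj₁ P∣x = here (irreducible-∣-irreducible P x irr x-irr P∣x)
  ... | inj₂ P∣S = there (irreducible-∣-prod⇒∈ P irr S S-irr P∣S)

  ¬squareful⇒factors-unique : ∀ Fs X → All IsIrreducible Fs → prod Fs ∣ X → ¬ Squareful F (proj₂ X) → Unique Fs
  ¬squareful⇒factors-unique [] X _ _ _ = []
  ¬squareful⇒factors-unique (p ∷ Fs) X (p-irr ∷ Fs-irr) p⊗Fs∣X X-squarefree =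
    All.tabulate (λ q∈Fs p≡q → X-squarefree (squareful⁺ p X p-irr
      (∣-trans {p ⊗ p} {p ⊗ prod Fs} {X} (⊗-monoʳ-∣ p (∈⇒∣prod Fs (subst (_∈ Fs) (sym p≡q) q∈Fs))) p⊗Fs∣X)))
    ∷ ¬squareful⇒factors-unique Fs X Fs-irr (∣-trans {prod Fs} {p ⊗ prod Fs} {X} (∣-⊗ʳ p (prod Fs)) p⊗Fs∣X) X-squarefree

  ∣-prod⇒sublist : ∀ Fs → All IsIrreducible Fs → ∀ g → g ∣ prod Fs → Σ (List MonicPoly) λ S → S ∈ sublists Fs × prod S ≡ g
  ∣-prod⇒sublist [] _ g g∣one = [] , here refl , sym (deg≡0⇒one g (ℕP.n≤0⇒n≡0 (∣⇒deg≤ g one g∣one)))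
  ∣-prod⇒sublist (p ∷ Fs) (p-irr ∷ Fs-irr) g (w , g⊗w≡p⊗Fs) with dividesB F (poly p) (proj₂ g) in p∣ᵇg
  ... | true with dividesB⇒∣ p (proj₂ g) p∣ᵇg
  ...   | g′ , p⊗g′≡g with ∣-prod⇒sublist Fs Fs-irr g′ (w , ⊗-cancelˡ p (g′ ⊗ w) (prod Fs)
                             (trans (sym (⊗-assoc p g′ w)) (trans (cong (_⊗ w) p⊗g′≡g) g⊗w≡p⊗Fs)))
  ...     | S , S∈ , S≡g′ = p ∷ S , ∈-++⁺ʳ (sublists Fs) (∈-map⁺ (p ∷_) S∈) , trans (cong (p ⊗_) S≡g′) p⊗g′≡g
  ∣-prod⇒sublist (p ∷ Fs) (p-irr ∷ Fs-irr) g (w , g⊗w≡p⊗Fs) | false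
    with irreducible-∣-⊗ p p-irr g w (prod Fs , sym g⊗w≡p⊗Fs)
  ... | inj₁ p∣g = ⊥-elim (false≢true (trans (sym p∣ᵇg) (∣⇒dividesB p (proj₂ g) p∣g)))
  ... | inj₂ (w′ , p⊗w′≡w) with ∣-prod⇒sublist Fs Fs-irr g (w′ , ⊗-cancelˡ p (g ⊗ w′) (prod Fs) p⊗g⊗w′≡p⊗Fs)
    where
    p⊗g⊗w′≡p⊗Fs : p ⊗ (g ⊗ w′) ≡ p ⊗ prod Fs
    p⊗g⊗w′≡p⊗Fs = trans (sym (⊗-assoc p g w′))
      (trans (cong (_⊗ w′) (⊗-comm p g)) (trans (⊗-assoc g p w′) (trans (cong (g ⊗_) p⊗w′≡w) g⊗w≡p⊗Fs)))
  ...   | S , S∈ , S≡g = S , ∈-++⁺ˡ S∈ , S≡g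

  sublist-prod-∣ : ∀ Fs {S} → S ∈ sublists Fs → prod S ∣ prod Fs
  sublist-prod-∣ [] (here refl) = ∣-refl one
  sublist-prod-∣ (p ∷ Fs) {S} S∈ with ∈-++⁻ (sublists Fs) S∈
  ... | inj₁ S∈rest = ∣-trans {prod S} {prod Fs} {p ⊗ prod Fs} (sublist-prod-∣ Fs S∈rest) (∣-⊗ʳ p (prod Fs))
  ... | inj₂ S∈p∷rest with ∈-map⁻ (p ∷_) S∈p∷rest
  ...   | S′ , S′∈ , refl = ⊗-monoʳ-∣ p (sublist-prod-∣ Fs S′∈)

  sublists-irreducible : ∀ Fs → All IsIrreducible Fs → ∀ {S} → S ∈ sublists Fs → All IsIrreducible S
  sublists-irreducible Fs Fs-irr S∈ = All.tabulate (λ q∈S → All.lookup Fs-irr (sublists-⊆ Fs S∈ q∈S))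

  prod-sublists-unique : ∀ Fs → All IsIrreducible Fs → Unique Fs → Unique (map prod (sublists Fs))
  prod-sublists-unique [] _ _ = All.[] ∷ []
  prod-sublists-unique (p ∷ Fs) (p-irr ∷ Fs-irr) (p∉Fs ∷ u)
    rewrite map-++ prod (sublists Fs) (map (p ∷_) (sublists Fs)) | sym (map-∘ {g = prod} {f = p ∷_} (sublists Fs))
          | map-∘ {g = p ⊗_} {f = prod} (sublists Fs) =
    Unique.++⁺ ih (Unique.map⁺ (λ {x} {y} → ⊗-cancelˡ p x y) ih) disjoint
    where
    ih = prod-sublists-unique Fs Fs-irr u
    disjoint : ∀ {v} → ¬ (v ∈ map prod (sublists Fs) × v ∈ map (p ⊗_) (map prod (sublists Fs)))
    disjoint (v∈ , v∈p⊗) with ∈-map⁻ prod v∈ | ∈-map⁻ (p ⊗_) v∈p⊗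
    ... | S , S∈ , refl | v′ , _ , S≡p⊗v′ =
      All.lookup p∉Fs (sublists-⊆ Fs S∈ (irreducible-∣-prod⇒∈ p p-irr S (sublists-irreducible Fs Fs-irr S∈) (v′ , sym S≡p⊗v′))) refl

  irreducibleDivisorsOfDegree : ∀ {n} → Monic F n → (e : ℕ) → List MonicPoly
  irreducibleDivisorsOfDegree g e = map (e ,_) (filterB (λ p → irrB F p ∧ dividesB F (toPoly F p) g) (allMonic F e))

  irreducibleDivisors : ∀ {n} → Monic F n → List MonicPoly
  irreducibleDivisors {n} g = concatMap (irreducibleDivisorsOfDegree g) (range1 F n)

  irrDivisorDegrees≡ : ∀ {n} (g : Monic F n) → irrDivisorDegrees F g ≡ map deg (irreducibleDivisors g)
  irrDivisorDegrees≡ {n} g = sym (go (range1 F n))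
    where
    go : ∀ es → map deg (concatMap (irreducibleDivisorsOfDegree g) es)
                ≡ concatMap (λ e → map (λ _ → e) (filterB (λ p → irrB F p ∧ dividesB F (toPoly F p) g) (allMonic F e))) es
    go [] = refl
    go (e ∷ es) = trans (map-++ deg (irreducibleDivisorsOfDegree g e) _) (cong₂ _++_ (sym (map-∘ _)) (go es))

  ,-injectiveʳ : ∀ {e} {p q : Monic F e} → _≡_ {A = MonicPoly} (e , p) (e , q) → p ≡ q
  ,-injectiveʳ refl = refl

  irreducibleDivisors-unique : ∀ {n} (g : Monic F n) → Unique (irreducibleDivisors g)
  irreducibleDivisors-unique {n} g =
    Unique-concatMap⁺ (irreducibleDivisorsOfDegree g) deg (Unique.map⁺ ℕP.suc-injective (Unique.upTo⁺ n))
      (λ e → Unique.map⁺ ,-injectiveʳ (filterB⁺ _ (allMonic-unique e))) deg-key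
    where
    deg-key : ∀ e {x} → x ∈ irreducibleDivisorsOfDegree g e → deg x ≡ e
    deg-key e x∈ with ∈-map⁻ (e ,_) x∈
    ... | _ , _ , refl = refl

  ∈-irreducibleDivisors⁻ : ∀ {n} (g : Monic F n) {x} → x ∈ irreducibleDivisors g → IsIrreducible x × x ∣ (n , g)
  ∈-irreducibleDivisors⁻ {n} g x∈ with ∈-concatMap⁻′ (irreducibleDivisorsOfDegree g) (range1 F n) x∈
  ... | e , _ , x∈e with ∈-map⁻ (e ,_) x∈e
  ...   | p , p∈ , refl with ∧-true⁻ {irrB F p} (proj₂ (∈-filterB⁻ _ {allMonic F e} p∈))
  ...     | p-irr , p∣g = irrB⇒IsIrreducible p p-irr , dividesB⇒∣ (e , p) g p∣g

  ∈-irreducibleDivisors⁺ : ∀ {n} (g : Monic F n) x → IsIrreducible x → x ∣ (n , g) → x ∈ irreducibleDivisors g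
  ∈-irreducibleDivisors⁺ {n} g (zero , p) (() , _) _
  ∈-irreducibleDivisors⁺ {n} g (suc e , p) x-irr x∣g =
    ∈-concatMap⁺′ (irreducibleDivisorsOfDegree g) {range1 F n} (∈-map⁺ suc (∈-upTo⁺ (∣⇒deg≤ (suc e , p) (n , g) x∣g)))
      (∈-map⁺ (suc e ,_) (∈-filterB⁺ _ (allMonic-complete (suc e) p) (cong₂ _∧_ (IsIrreducible⇒irrB p x-irr) (∣⇒dividesB (suc e , p) g x∣g))))

  irreducibleDivisors-prod-↭ : ∀ Ss → Unique Ss → All IsIrreducible Ss → irreducibleDivisors (proj₂ (prod Ss)) ↭ Ss
  irreducibleDivisors-prod-↭ Ss u Ss-irr = Unique⇒↭ (irreducibleDivisors-unique (proj₂ (prod Ss))) u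
    (λ {x} x∈ → let x-irr , x∣Ss = ∈-irreducibleDivisors⁻ (proj₂ (prod Ss)) x∈ in irreducible-∣-prod⇒∈ x x-irr Ss Ss-irr x∣Ss)
    (λ {x} x∈Ss → ∈-irreducibleDivisors⁺ (proj₂ (prod Ss)) x (All.lookup Ss-irr x∈Ss) (∈⇒∣prod Ss x∈Ss))

  signℤ≡sgn : ∀ k → signℤ F k ≡ sgn k
  signℤ≡sgn zero = refl
  signℤ≡sgn (suc k) = cong ℤ.-_ (signℤ≡sgn k)

  μ-prod : ∀ Ss → Unique Ss → All IsIrreducible Ss → ¬ Squareful F (proj₂ (prod Ss)) → μ F (proj₂ (prod Ss)) ≡ sgn (length Ss)
  μ-prod Ss u Ss-irr squarefree
    rewrite ¬Squareful⇒squarefreeB (proj₂ (prod Ss)) squarefree | irrDivisorDegrees≡ (proj₂ (prod Ss))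
          | length-map deg (irreducibleDivisors (proj₂ (prod Ss))) | ↭-length (irreducibleDivisors-prod-↭ Ss u Ss-irr)
    = signℤ≡sgn (length Ss)

  mulP≡⇒⊗≡ : ∀ x y z → mulP F (poly x) (poly y) ≡ poly z → x ⊗ y ≡ z
  mulP≡⇒⊗≡ x y z xy≡z = poly-injective (x ⊗ y) z (≡⇒≈ (trans (poly-⊗ x y) xy≡z))

module HigherVonMangoldt (F : FiniteField) where

  open import Data.Bool using (Bool; true; false; if_then_else_)
  open import Data.Empty using (⊥-elim)
  open import Data.Integer as ℤ using (ℤ; 0ℤ; +_)
  import Data.Integer.Properties as ℤP
  open import Data.List using (List; []; _∷_; map; length; concatMap; upTo)
  open import Data.List.Membership.Propositional using (_∈_)
  open import Data.List.Membership.Propositional.Properties using (∈-map⁺; ∈-map⁻; ∈-upTo⁺)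
  open import Data.List.Properties using (map-∘)
  open import Data.List.Relation.Binary.Permutation.Propositional using (_↭_; ↭-sym)
  open import Data.List.Relation.Binary.Permutation.Propositional.Properties using (map⁺; All-resp-↭)
  open import Data.List.Relation.Unary.All as All using (All; []; _∷_)
  import Data.List.Relation.Unary.All.Properties as All
  open import Data.List.Relation.Unary.Unique.Propositional using (Unique)
  import Data.List.Relation.Unary.Unique.Propositional.Properties as Unique
  open import Data.Nat as ℕ using (ℕ; suc; _≤_; _<_; _∸_; _^_; s≤s)
  open import Data.Nat.ListAction using (sum)
  open import Data.Nat.ListAction.Properties using (sum-↭)
  import Data.Nat.Properties as ℕP
  open import Data.Product using (Σ; _×_; _,_; proj₁; proj₂)
  open import Function using (_∘′_)
  open import Relation.Binary.PropositionalEquality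
  open import Relation.Nullary using (¬_)
  open Lists
  open HookCharacters
  open MonicPolynomials F
  open Factorisation F

  -- Only the cofactor f / g can satisfy g·h = f, and it exists exactly when g ∣ f.
  cofactor-sum : ∀ {n d} (f : Monic F n) (g : Monic F d) (c : ℤ) →
    sumZ (map (λ h → if eqP F (mulP F (toPoly F g) (toPoly F h)) (toPoly F f) then c else 0ℤ) (allMonic F (n ∸ d)))
    ≡ (if dividesB F (toPoly F g) f then c else 0ℤ)
  cofactor-sum {n} {d} f g c with dividesB F (toPoly F g) f in g∣ᵇf
  ... | true = sumZ-map-if-unique _ c (allMonic-unique (n ∸ d)) (allMonic-complete _ h₀) (eqP-true g⊗h₀≡f) only-h₀
    where
    g∣f = dividesB⇒∣ (d , g) f g∣ᵇf
    z = proj₁ g∣f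
    deg-z : deg z ≡ n ∸ d
    deg-z = trans (sym (ℕP.m+n∸m≡n d (deg z))) (cong (λ x → deg x ∸ d) (proj₂ g∣f))
    h₀ : Monic F (n ∸ d)
    h₀ = subst (Monic F) deg-z (proj₂ z)
    z≡h₀ : z ≡ (n ∸ d , h₀)
    z≡h₀ = poly-injective z (n ∸ d , h₀) (≡⇒≈ (sym (toPoly-subst deg-z (proj₂ z))))
    g⊗h₀≡f : mulP F (toPoly F g) (toPoly F h₀) ≡ toPoly F f
    g⊗h₀≡f = trans (cong (mulP F (toPoly F g)) (toPoly-subst deg-z (proj₂ z))) (trans (sym (poly-⊗ (d , g) z)) (cong poly (proj₂ g∣f)))
    only-h₀ : ∀ {h} → h ∈ allMonic F (n ∸ d) → eqP F (mulP F (toPoly F g) (toPoly F h)) (toPoly F f) ≡ true → h ≡ h₀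
    only-h₀ {h} _ gh≡f = ,-injectiveʳ (⊗-cancelˡ (d , g) (n ∸ d , h) (n ∸ d , h₀)
      (trans (mulP≡⇒⊗≡ (d , g) (n ∸ d , h) (n , f) (eqP-true⁻ gh≡f)) (trans (sym (proj₂ g∣f)) (cong ((d , g) ⊗_) z≡h₀))))
  ... | false = sumZ-map-zero _ (allMonic F (n ∸ d)) vanishes
    where
    vanishes : ∀ {h} → h ∈ allMonic F (n ∸ d) →
      (if eqP F (mulP F (toPoly F g) (toPoly F h)) (toPoly F f) then c else 0ℤ) ≡ 0ℤ
    vanishes {h} _ with eqP F (mulP F (toPoly F g) (toPoly F h)) (toPoly F f) in gh≡ᵇf
    ... | false = refl
    ... | true = ⊥-elim (false≢true (trans (sym g∣ᵇf)
                   (∣⇒dividesB (d , g) f ((n ∸ d , h) , mulP≡⇒⊗≡ (d , g) (n ∸ d , h) (n , f) (eqP-true⁻ gh≡ᵇf)))))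

  monicsOfDegreeAtMost : ℕ → List MonicPoly
  monicsOfDegreeAtMost n = concatMap (λ d → map (d ,_) (allMonic F d)) (range0 F n)

  Λ≡divisor-sum : ∀ {n} j (f : Monic F n) →
    Λ F j f ≡ sumZ (map (λ x → if dividesB F (poly x) f then μ F (proj₂ x) ℤ.* + ((n ∸ deg x) ^ j) else 0ℤ) (monicsOfDegreeAtMost n))
  Λ≡divisor-sum {n} j f =
    trans (sumZ-map-cong _ _ (range0 F n) (λ {d} _ →
             trans (sumZ-map-cong _ _ (allMonic F d) (λ {g} _ → cofactor-sum f g (μ F g ℤ.* + ((n ∸ d) ^ j))))
                   (cong sumZ (map-∘ {g = term} {f = d ,_} (allMonic F d)))))
          (sumZ-concatMap term (λ d → map (d ,_) (allMonic F d)) (range0 F n))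
    where
    term : MonicPoly → ℤ
    term x = if dividesB F (poly x) f then μ F (proj₂ x) ℤ.* + ((n ∸ deg x) ^ j) else 0ℤ

  monicsOfDegreeAtMost-unique : ∀ n → Unique (monicsOfDegreeAtMost n)
  monicsOfDegreeAtMost-unique n =
    Unique-concatMap⁺ (λ d → map (d ,_) (allMonic F d)) deg (Unique.upTo⁺ (suc n))
      (λ d → Unique.map⁺ ,-injectiveʳ (allMonic-unique d)) deg-key
    where
    deg-key : ∀ d {x} → x ∈ map (d ,_) (allMonic F d) → deg x ≡ d
    deg-key d x∈ with ∈-map⁻ (d ,_) x∈
    ... | _ , _ , refl = refl

  ∈-monicsOfDegreeAtMost : ∀ {n} x → deg x ≤ n → x ∈ monicsOfDegreeAtMost n
  ∈-monicsOfDegreeAtMost (d , g) d≤n =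
    ∈-concatMap⁺′ (λ d → map (d ,_) (allMonic F d)) (∈-upTo⁺ (s≤s d≤n)) (∈-map⁺ (d ,_) (allMonic-complete d g))

  deg-prod : ∀ Ss → deg (prod Ss) ≡ sum (map deg Ss)
  deg-prod [] = refl
  deg-prod (x ∷ Ss) = cong (deg x ℕ.+_) (deg-prod Ss)

  module SquarefreeFactorisation {n} (f : Monic F n) (squarefree : ¬ Squareful F f) where

    private
      factorisation = factorise (suc n) (n , f) ℕP.≤-refl

    divides-f : MonicPoly → Bool
    divides-f x = dividesB F (poly x) f

    factors : List MonicPoly
    factors = proj₁ factorisation

    factors-irreducible : All IsIrreducible factors
    factors-irreducible = proj₁ (proj₂ factorisation)

    prod-factors : prod factors ≡ (n , f)
    prod-factors = proj₂ (proj₂ factorisation)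

    factors-unique : Unique factors
    factors-unique = ¬squareful⇒factors-unique factors (n , f) factors-irreducible (subst (prod factors ∣_) prod-factors (∣-refl (prod factors))) squarefree

    divisors↭sublist-prods : filterB divides-f (monicsOfDegreeAtMost n) ↭ map prod (sublists factors)
    divisors↭sublist-prods = Unique⇒↭ (filterB⁺ divides-f (monicsOfDegreeAtMost-unique n)) (prod-sublists-unique factors factors-irreducible factors-unique)
      (λ {x} x∈ → let S , S∈ , S≡x = ∣-prod⇒sublist factors factors-irreducible x
                                       (subst (x ∣_) (sym prod-factors) (dividesB⇒∣ x f (proj₂ (∈-filterB⁻ divides-f {monicsOfDegreeAtMost n} x∈))))
                  in subst (_∈ map prod (sublists factors)) S≡x (∈-map⁺ prod S∈))
      (λ {x} x∈ → let S , S∈ , S≡x = ∈-map⁻ prod x∈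
                      x∣f = subst (x ∣_) prod-factors (subst (_∣ prod factors) (sym S≡x) (sublist-prod-∣ factors S∈))
                  in ∈-filterB⁺ divides-f (∈-monicsOfDegreeAtMost x (∣⇒deg≤ x (n , f) x∣f)) (∣⇒dividesB x f x∣f))

    degrees↭ : irrDivisorDegrees F f ↭ map deg factors
    degrees↭ = subst (_↭ map deg factors) (sym (irrDivisorDegrees≡ f))
      (map⁺ deg (subst (λ x → irreducibleDivisors (proj₂ x) ↭ factors) prod-factors
                  (irreducibleDivisors-prod-↭ factors factors-unique factors-irreducible)))

    degrees-sum : sum (irrDivisorDegrees F f) ≡ n
    degrees-sum = trans (sum-↭ degrees↭) (trans (sym (deg-prod factors)) (cong deg prod-factors))

    degrees-positive : All (1 ≤_) (irrDivisorDegrees F f)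
    degrees-positive = All-resp-↭ (↭-sym degrees↭) (All.map⁺ (All.map proj₁ factors-irreducible))

    Λ≡signedSubsetSum : ∀ j → Λ F j f ≡ signedSubsetSum (irrDivisorDegrees F f) (λ s → + ((n ∸ s) ^ j))
    Λ≡signedSubsetSum j = begin
      Λ F j f
        ≡⟨ Λ≡divisor-sum j f ⟩
      sumZ (map (λ x → if divides-f x then weight x else 0ℤ) (monicsOfDegreeAtMost n))
        ≡⟨ sumZ-map-if divides-f weight (monicsOfDegreeAtMost n) ⟩
      sumZ (map weight (filterB divides-f (monicsOfDegreeAtMost n)))
        ≡⟨ sumZ-↭ (map⁺ weight divisors↭sublist-prods) ⟩
      sumZ (map weight (map prod (sublists factors)))
        ≡⟨ cong sumZ (map-∘ (sublists factors)) ⟨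
      sumZ (map (weight ∘′ prod) (sublists factors))
        ≡⟨ sumZ-map-cong _ _ (sublists factors) weight-prod ⟩
      sumZ (map (λ S → sgn (length S) ℤ.* φ (sum (map deg S))) (sublists factors))
        ≡⟨ sumZ-sublists deg factors φ ⟩
      signedSubsetSum (map deg factors) φ
        ≡⟨ signedSubsetSum-↭ (↭-sym degrees↭) φ ⟩
      signedSubsetSum (irrDivisorDegrees F f) φ ∎
      where
      open ≡-Reasoning
      φ : ℕ → ℤ
      φ s = + ((n ∸ s) ^ j)
      weight : MonicPoly → ℤ
      weight x = μ F (proj₂ x) ℤ.* φ (deg x)
      weight-prod : ∀ {S} → S ∈ sublists factors → weight (prod S) ≡ sgn (length S) ℤ.* φ (sum (map deg S))
      weight-prod {S} S∈ = cong₂ (λ u s → u ℤ.* φ s)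
        (μ-prod S (sublists-unique factors factors-unique S∈) (sublists-irreducible factors factors-irreducible S∈)
          (¬squareful-∣ (n , f) (prod S) squarefree (subst (prod S ∣_) prod-factors (sublist-prod-∣ factors S∈))))
        (deg-prod S)

    hookSum≡signedSubsetSum : ∀ j → 1 ≤ n → hookSum F n j f ≡ signedSubsetSum (irrDivisorDegrees F f) (λ s → + ((n ∸ s) ^ j))
    hookSum≡signedSubsetSum j 1≤n = begin
      sumZ (map term (map suc (upTo n)))
        ≡⟨ sumZ-map-suc-upTo n term ⟩
      sumBelow n (λ t → term (n ∸ t))
        ≡⟨ sumBelow-cong n reindexed ⟩
      sumBelow n (λ t → sgn t ℤ.* (φ t ℤ.- φ (suc t)) ℤ.* χ (hook n (n ∸ t)) D)
        ≡⟨ χ-hook-expansion n D degrees-sum degrees-positive D≢[] φ ⟩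
      signedSubsetSum D φ ∎
      where
      open ≡-Reasoning
      D = irrDivisorDegrees F f
      φ : ℕ → ℤ
      φ s = + ((n ∸ s) ^ j)
      term : ℕ → ℤ
      term r = sgn (n ∸ r) ℤ.* (+ (r ^ j) ℤ.- + ((r ∸ 1) ^ j)) ℤ.* Xpoly F (hook n r) f
      D≢[] : D ≢ []
      D≢[] D≡[] = ℕP.<⇒≢ 1≤n (trans (sym (cong sum D≡[])) degrees-sum)
      reindexed : ∀ t → t < n → term (n ∸ t) ≡ sgn t ℤ.* (φ t ℤ.- φ (suc t)) ℤ.* χ (hook n (n ∸ t)) D
      reindexed t t<n
        rewrite ℕP.m∸[m∸n]≡n (ℕP.<⇒≤ t<n) | ℕP.∸-+-assoc n t 1 | ℕP.+-comm t 1
              | ¬Squareful⇒squarefreeB f squarefree = refl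

    Λ≡hookSum : ∀ j → 1 ≤ n → Λ F j f ≡ hookSum F n j f
    Λ≡hookSum j 1≤n = trans (Λ≡signedSubsetSum j) (sym (hookSum≡signedSubsetSum j 1≤n))

open import Data.Nat using (ℕ; _≤_)
open import Data.Integer using (ℤ; 0ℤ; _+_)
open import Data.Product using (Σ; _×_; _,_)
open import Relation.Nullary using (¬_)
open import Relation.Binary.PropositionalEquality using (_≡_; sym; trans; cong)
import Data.Integer as ℤ
import Data.Integer.Properties as ℤP
open HigherVonMangoldt using (module SquarefreeFactorisation)

proposition9p4 : (q : ℕ) → IsPrimePower q →
    (F : FiniteField) → FiniteField.size F ≡ q →
    (n j : ℕ) → 1 ≤ n → 1 ≤ j →
    Σ (Monic F n → ℤ) λ b →
      (∀ f → ¬ Squareful F f → b f ≡ 0ℤ) ×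
      (∀ f → Λ F j f ≡ hookSum F n j f + b f)
proposition9p4 _ _ F _ n j 1≤n _ = b , b-vanishes , Λ≡hookSum+b
  where
  b : Monic F n → ℤ
  b f = ℤ.- hookSum F n j f + Λ F j f
  b-vanishes : ∀ f → ¬ Squareful F f → b f ≡ 0ℤ
  b-vanishes f squarefree =
    trans (cong (ℤ.- hookSum F n j f +_) (SquarefreeFactorisation.Λ≡hookSum F f squarefree j 1≤n))
          (ℤP.+-inverseˡ (hookSum F n j f))
  Λ≡hookSum+b : ∀ f → Λ F j f ≡ hookSum F n j f + b f
  Λ≡hookSum+b f = sym (trans (sym (ℤP.+-assoc h (ℤ.- h) (Λ F j f)))
                             (trans (cong (_+ Λ F j f) (ℤP.+-inverseʳ h)) (ℤP.+-identityˡ (Λ F j f))))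
    where h = hookSum F n j f
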